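{- Let $I$ be an interval-poset of size $n$ and $(T,\ell)=\mathrm{Graft}(I)$ its grafting tree, with nodes $v_1,\dots,v_n$ in in-order. Then $T$ is the upper bound binary tree of $I$, and for each $i$, $\ell(v_i)$ is the number of decreasing children of vertex $i$ in $I$.
   Context: An interval-poset of size $n$ is a partial order $\triangleleft$ on $\{1,\dots,n\}$ with $a\triangleleft c\Rightarrow b\triangleleft c$ and $c\triangleleft a\Rightarrow b\triangleleft a$ for all $a<b<c$. Decreasing relations are $x\triangleleft y$ with $x>y$; the decreasing children of $b$ are the $c>b$ with $c\triangleleft b$ a cover relation of the poset of decreasing relations; a decreasing root is a vertex $b$ with no $a<b$ such that $b\triangleleft a$. The interval-poset of a Tamari interval $[T_1,T_2]$ of binary trees (nodes $v_1,\dots,v_n$ in in-order; Tamari order generated by right rotations $y(x(A,B),C)\to x(A,y(B,C))$) has, for $a<b$, $b\triangleleft a$ iff $v_b$ is in the right subtree of $v_a$ in $T_1$, and $a\triangleleft b$ iff $v_a$ is in the left subtree of $v_b$ in $T_2$; $T_2$ is the upper bound binary tree. $u$ is the interval-poset of size $1$. Shifted concatenation of $I_1$ (size $n_1$) and $I_2$: relations of $I_1$ and of $I_2$ shifted by $n_1$. Left grafting $I_1\prec I_2$ ($I_2$ nonempty): add $y\triangleleft n_1+1$ for all $y\le n_1$; $\emptyset\prec I_2=I_2$. Right grafting $I_1\succ_r I_2$ ($I_1$ nonempty, $0\le r\le c$, $y_1<\dots<y_c$ the decreasing roots of $I_2$ shifted by $n_1$): add $y_i\triangleleft n_1$ for $i\le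 r$; $I_1\succ_0\emptyset=I_1$. A grafting tree is a binary tree $T$ with labels $\ell(v)\in\mathbb{N}$ such that $\ell(v)\le\mathrm{size}(T_R(v))-\sum_{w\in T_R(v)}\ell(w)$ for every node $v$ ($T_R(v)$ the right subtree). $\mathrm{Graft}^{ -1}(\emptyset)=\emptyset$ and $\mathrm{Graft}^{ -1}(T,\ell)=\mathrm{Graft}^{ -1}(T_L,\ell)\prec(u\succ_{\ell(\mathrm{root})}\mathrm{Graft}^{ -1}(T_R,\ell))$; this is a bijection from grafting trees to interval-posets, and $\mathrm{Graft}$ denotes its inverse. -}

module Defs where

open import Data.Nat using (ℕ; zero; suc; _+_; _∸_; _≤_; _<_; _≡ᵇ_; _≤ᵇ_; _<ᵇ_)
open import Data.Bool using (Bool; true; false; _∧_; _∨_; not; T; if_then_else_)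
open import Data.List using (List; []; _∷_; map; length; filterᵇ; take; applyUpTo)
open import Data.Bool.ListAction using (any)
open import Data.Product using (_×_; Σ)
open import Data.Unit using (⊤)
open import Relation.Binary.PropositionalEquality using (_≡_)
open import Relation.Binary.Construct.Closure.ReflexiveTransitive using (Star)

data BinTree : Set where
  leaf : BinTree
  node : BinTree → BinTree → BinTree

nodes : BinTree → ℕ
nodes leaf       = 0
nodes (node L R) = suc (nodes L + nodes R)

data Rot : BinTree → BinTree → Set where
  rot-here  : ∀ A B C → Rot (node (node A B) C) (node A (node B C))
  rot-left  : ∀ {L L′} R → Rot L L′ → Rot (node L R) (node L′ R)
  rot-right : ∀ L {R R′} → Rot R R′ → Rot (node L R) (node L R′)

_≤Tam_ : BinTree → BinTree → Set
_≤Tam_ = Star Rot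

record IPos : Set where
  field
    size : ℕ
    rel  : ℕ → ℕ → Bool   -- rel x y = true  means  x ◁ y
open IPos public

inRangeᵇ : ℕ → ℕ → ℕ → Bool
inRangeᵇ x lo hi = (lo ≤ᵇ x) ∧ (x ≤ᵇ hi)

-- [lo+1, …, lo+k]
range : ℕ → ℕ → List ℕ
range lo k = map (lo +_) (applyUpTo suc k)

record IsIntervalPoset (I : IPos) : Set where
  field
    support  : ∀ x y → T (rel I x y) → (1 ≤ x × x ≤ size I) × (1 ≤ y × y ≤ size I)
    reflexive : ∀ x → 1 ≤ x → x ≤ size I → T (rel I x x)
    antisym  : ∀ x y → T (rel I x y) → T (rel I y x) → x ≡ y
    transitive : ∀ x y z → T (rel I x y) → T (rel I y z) → T (rel I x z)
    interval₁ : ∀ a b c → a < b → b < c → T (rel I a c) → T (rel I b c)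
    interval₂ : ∀ a b c → a < b → b < c → T (rel I c a) → T (rel I b a)

_≅_ : IPos → IPos → Set
I ≅ J = (size I ≡ size J) ×
        (∀ x y → 1 ≤ x → x ≤ size I → 1 ≤ y → y ≤ size I → rel I x y ≡ rel J x y)

-- leftSubᵇ t k x y : node x lies in the left subtree of node y,
-- where the nodes of t are numbered k+1, …, k + nodes t in in-order
leftSubᵇ : BinTree → ℕ → ℕ → ℕ → Bool
leftSubᵇ leaf k x y = false
leftSubᵇ (node L R) k x y =
  ((y ≡ᵇ suc (k + nodes L)) ∧ inRangeᵇ x (suc k) (k + nodes L))
  ∨ leftSubᵇ L k x y ∨ leftSubᵇ R (suc (k + nodes L)) x y

rightSubᵇ : BinTree → ℕ → ℕ → ℕ → Bool
rightSubᵇ leaf k x y = false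
rightSubᵇ (node L R) k x y =
  ((y ≡ᵇ suc (k + nodes L)) ∧ inRangeᵇ x (suc (suc (k + nodes L))) (suc (k + nodes L + nodes R)))
  ∨ rightSubᵇ L k x y ∨ rightSubᵇ R (suc (k + nodes L)) x y

IP : BinTree → BinTree → IPos
IP T₁ T₂ = record
  { size = nodes T₂
  ; rel  = λ x y →
      if x ≡ᵇ y then inRangeᵇ x 1 (nodes T₂)
      else if x <ᵇ y then leftSubᵇ T₂ 0 x y
      else rightSubᵇ T₁ 0 x y
  }

warshall : ℕ → (ℕ → ℕ → Bool) → (ℕ → ℕ → Bool)
warshall zero    R = R
warshall (suc k) R = λ x y → S x y ∨ (S x (suc k) ∧ S (suc k) y)
  where S = warshall k R

emptyIP : IPos
emptyIP = record { size = 0 ; rel = λ _ _ → false }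

uIP : IPos
uIP = record { size = 1 ; rel = λ x y → (x ≡ᵇ 1) ∧ (y ≡ᵇ 1) }

shiftRel : ℕ → (ℕ → ℕ → Bool) → (ℕ → ℕ → Bool)
shiftRel k R x y = (k <ᵇ x) ∧ (k <ᵇ y) ∧ R (x ∸ k) (y ∸ k)

concatRel : IPos → IPos → ℕ → ℕ → Bool
concatRel I₁ I₂ x y = rel I₁ x y ∨ shiftRel (size I₁) (rel I₂) x y

decRoots : IPos → List ℕ
decRoots I = filterᵇ (λ b → not (any (λ a → rel I b a) (range 0 (b ∸ 1)))) (range 0 (size I))

leftGraft : IPos → IPos → IPos
leftGraft I₁ I₂ = record
  { size = size I₁ + size I₂
  ; rel  = warshall (size I₁ + size I₂) (λ x y →
      concatRel I₁ I₂ x y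
      ∨ ((0 <ᵇ size I₂) ∧ inRangeᵇ x 1 (size I₁) ∧ (y ≡ᵇ suc (size I₁))))
  }

rightGraft : IPos → ℕ → IPos → IPos
rightGraft I₁ r I₂ = record
  { size = size I₁ + size I₂
  ; rel  = warshall (size I₁ + size I₂) (λ x y →
      concatRel I₁ I₂ x y
      ∨ ((y ≡ᵇ size I₁) ∧ any (λ z → x ≡ᵇ z) (take r (map (size I₁ +_) (decRoots I₂)))))
  }

data LTree : Set where
  lleaf : LTree
  lnode : LTree → ℕ → LTree → LTree

shape : LTree → BinTree
shape lleaf         = leaf
shape (lnode L _ R) = node (shape L) (shape R)

lsize : LTree → ℕ
lsize t = nodes (shape t)

lsum : LTree → ℕ
lsum lleaf         = 0
lsum (lnode L l R) = lsum L + l + lsum R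

-- ℓ(v) ≤ size(T_R(v)) − Σ_{w ∈ T_R(v)} ℓ(w) at every node (stated without truncated subtraction)
IsGraftingTree : LTree → Set
IsGraftingTree lleaf         = ⊤
IsGraftingTree (lnode L l R) = IsGraftingTree L × IsGraftingTree R × (l + lsum R ≤ lsize R)

-- label of the i-th node in in-order (1-indexed)
labelAt : LTree → ℕ → ℕ
labelAt lleaf         i = 0
labelAt (lnode L l R) i =
  if i ≤ᵇ lsize L then labelAt L i
  else if i ≡ᵇ suc (lsize L) then l
  else labelAt R (i ∸ suc (lsize L))

graftInv : LTree → IPos
graftInv lleaf         = emptyIP
graftInv (lnode L l R) = leftGraft (graftInv L) (rightGraft uIP l (graftInv R))

-- Decreasing children of b: the c > b with c ◁ b a cover relation of the
-- poset of decreasing relations, i.e. no d with c > d > b, c ◁ d, d ◁ b.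
decChildren : IPos → ℕ → ℕ
decChildren I b = length (filterᵇ
  (λ c → rel I c b ∧ not (any (λ d → rel I c d ∧ rel I d b) (range b (c ∸ suc b))))
  (range b (size I ∸ b)))

module Submission where

-- Graft⁻¹ t is described explicitly as the interval-poset
-- IP (lower t) (shape t), where the lower tree is a left comb whose right
-- subtrees form a forest defined by recursion on t: at a node (L, l, R)
-- the root takes the first l trees of the forest of R — those hanging from
-- the l decreasing roots that u ≻_l attaches to it — as its right subtree.
--
-- As
-- lower t ≤ shape t in the Tamari order, shape t is the upper bound tree.
-- Finally, the decreasing children of i in IP T₁ T₂ are the left-spine
-- nodes of the right subtree of v_i in T₁, whose number is the label.

open import Defs
open import Data.Nat using (ℕ; zero; suc; _+_; _∸_; _≤_; _<_; _≡ᵇ_; _≤ᵇ_; _<ᵇ_; _⊓_; z≤n; s≤s)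
open import Data.Nat.Properties
open import Data.Nat.Solver using (module +-*-Solver)
open import Data.Bool using (Bool; true; false; _∧_; _∨_; not; T; if_then_else_)
open import Data.Bool.Properties using (T-∧; T-∨; T-≡; T-not-≡; ∨-identityʳ; ∧-identityʳ; ∨-assoc)
open import Data.Bool.ListAction using (any)
open import Data.List using (List; []; _∷_; map; length; filterᵇ; take; drop; applyUpTo; _++_; foldl)
open import Data.List.Properties
  using (map-applyUpTo; foldl-++; length-++; length-take; length-drop; take-map; take++drop≡id;
         ++-assoc; ++-identityʳ; filter-++; filter-accept; filter-none)
open import Data.List.Membership.Propositional using (_∈_; find; lose)
open import Data.List.Membership.Propositional.Properties using (∈-++⁻; ∈-++⁺ˡ; ∈-++⁺ʳ; ∈-map⁺; ∈-map⁻)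
open import Data.List.Relation.Unary.Any using (here; there)
open import Data.List.Relation.Unary.Any.Properties using (any⁺; any⁻)
import Data.List.Relation.Unary.All as All
open import Data.Product using (_×_; Σ; _,_; proj₁; proj₂)
open import Data.Sum using (_⊎_; inj₁; inj₂)
open import Data.Unit using (tt)
open import Data.Empty using (⊥; ⊥-elim)
open import Function.Bundles using (Equivalence)
open import Relation.Nullary using (yes; no)
open import Relation.Nullary.Decidable using (T?)
open import Relation.Binary.Definitions using (tri<; tri≈; tri>)
open import Relation.Binary.PropositionalEquality using (_≡_; refl; sym; trans; cong; cong₂; subst; subst₂; module ≡-Reasoning)
open import Relation.Binary.Construct.Closure.ReflexiveTransitive using (ε; _◅_; _◅◅_; gmap)

T-ext : ∀ {a b} → (T a → T b) → (T b → T a) → a ≡ b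
T-ext {true}  {true}  _ _ = refl
T-ext {true}  {false} f _ = ⊥-elim (f tt)
T-ext {false} {true}  _ g = ⊥-elim (g tt)
T-ext {false} {false} _ _ = refl

T-∨⁻ : ∀ a {b} → T (a ∨ b) → T a ⊎ T b
T-∨⁻ a = Equivalence.to (T-∨ {a})

T-∨ˡ : ∀ a {b} → T a → T (a ∨ b)
T-∨ˡ a t = Equivalence.from (T-∨ {a}) (inj₁ t)

T-∨ʳ : ∀ a {b} → T b → T (a ∨ b)
T-∨ʳ a t = Equivalence.from (T-∨ {a}) (inj₂ t)

T-∧⁻ : ∀ a {b} → T (a ∧ b) → T a × T b
T-∧⁻ a = Equivalence.to (T-∧ {a})

T-∧⁺ : ∀ {a b} → T a → T b → T (a ∧ b)
T-∧⁺ {a} s t = Equivalence.from (T-∧ {a}) (s , t)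

T⇒≡true : ∀ {a} → T a → a ≡ true
T⇒≡true = Equivalence.to T-≡

¬T⇒≡false : ∀ {a} → (T a → ⊥) → a ≡ false
¬T⇒≡false {true}  f = ⊥-elim (f tt)
¬T⇒≡false {false} _ = refl

T-not⁻ : ∀ {a} → T (not a) → T a → ⊥
T-not⁻ t s = subst T (Equivalence.to T-not-≡ t) s

≤ᵇ⁻ : ∀ {a b} → T (a ≤ᵇ b) → a ≤ b
≤ᵇ⁻ {a} {b} = ≤ᵇ⇒≤ a b

≡ᵇ⁻ : ∀ {a b} → T (a ≡ᵇ b) → a ≡ b
≡ᵇ⁻ {a} {b} = ≡ᵇ⇒≡ a b

≡ᵇ⁺ : ∀ {a b} → a ≡ b → T (a ≡ᵇ b)
≡ᵇ⁺ {a} {b} = ≡⇒≡ᵇ a b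

≤ᵇ-suc : ∀ x z → (suc x ≤ᵇ suc z) ≡ (x ≤ᵇ z)
≤ᵇ-suc zero    z = refl
≤ᵇ-suc (suc x) z = refl

inRange⁻ : ∀ {x lo hi} → T (inRangeᵇ x lo hi) → lo ≤ x × x ≤ hi
inRange⁻ {x} {lo} t with T-∧⁻ (lo ≤ᵇ x) t
... | a , b = ≤ᵇ⁻ a , ≤ᵇ⁻ b

inRange⁺ : ∀ {x lo hi} → lo ≤ x → x ≤ hi → T (inRangeᵇ x lo hi)
inRange⁺ a b = T-∧⁺ (≤⇒≤ᵇ a) (≤⇒≤ᵇ b)

-- Ranges of natural numbers.  rng k n = [k+1, …, k+n] is a structurally recursive
-- form of Defs.range; every finite search in Defs runs over such a range.

rng : ℕ → ℕ → List ℕ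
rng k zero    = []
rng k (suc n) = suc k ∷ rng (suc k) n

range≡rng : ∀ k n → range k n ≡ rng k n
range≡rng k n = trans (map-applyUpTo suc (k +_) n) (go _ k n (λ _ → refl))
  where
  go : ∀ f k n → (∀ i → f i ≡ k + suc i) → applyUpTo f n ≡ rng k n
  go f k zero    _ = refl
  go f k (suc n) h = cong₂ _∷_ (trans (h 0) (trans (+-suc k 0) (cong suc (+-identityʳ k))))
    (go (λ i → f (suc i)) (suc k) n (λ i → trans (h (suc i)) (+-suc k (suc i))))

InR : ℕ → ℕ → ℕ → Set
InR k n x = k < x × x ≤ k + n

rng-∈⁻ : ∀ {k n x} → x ∈ rng k n → InR k n x
rng-∈⁻ {k} {suc n} (here refl) = ≤-refl , subst (suc k ≤_) (sym (+-suc k n)) (s≤s (m≤m+n k n))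
rng-∈⁻ {k} {suc n} {x} (there m) with rng-∈⁻ {suc k} {n} m
... | a , b = <-trans (n<1+n k) a , subst (x ≤_) (sym (+-suc k n)) b

rng-∈⁺ : ∀ {k n x} → InR k n x → x ∈ rng k n
rng-∈⁺ {k} {zero}  {x} (a , b) = ⊥-elim (<⇒≱ a (subst (x ≤_) (+-identityʳ k) b))
rng-∈⁺ {k} {suc n} {x} (a , b) with <-cmp (suc k) x
... | tri< lt _ _  = there (rng-∈⁺ (lt , subst (x ≤_) (+-suc k n) b))
... | tri≈ _ refl _ = here refl
... | tri> _ _ gt  = ⊥-elim (<⇒≱ a (≤-pred gt))

rng-+ : ∀ k a b → rng k (a + b) ≡ rng k a ++ rng (k + a) b
rng-+ k zero    b = cong (λ z → rng z b) (sym (+-identityʳ k))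
rng-+ k (suc a) b = cong (suc k ∷_)
  (trans (rng-+ (suc k) a b) (cong (λ z → rng (suc k) a ++ rng z b) (sym (+-suc k a))))

filterᵇ-cong : ∀ (p q : ℕ → Bool) xs → (∀ x → x ∈ xs → p x ≡ q x) → filterᵇ p xs ≡ filterᵇ q xs
filterᵇ-cong p q []       h = refl
filterᵇ-cong p q (x ∷ xs) h with p x | q x | h x (here refl)
... | true  | .true  | refl = cong (x ∷_) (filterᵇ-cong p q xs (λ y m → h y (there m)))
... | false | .false | refl = filterᵇ-cong p q xs (λ y m → h y (there m))

filterᵇ-none : ∀ (p : ℕ → Bool) xs → (∀ x → x ∈ xs → T (p x) → ⊥) → filterᵇ p xs ≡ []
filterᵇ-none p xs h = filter-none (λ x → T? (p x)) (All.tabulate (λ m → h _ m))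

any-cong : ∀ (p q : ℕ → Bool) xs → (∀ x → x ∈ xs → p x ≡ q x) → any p xs ≡ any q xs
any-cong p q []       h = refl
any-cong p q (x ∷ xs) h = cong₂ _∨_ (h x (here refl)) (any-cong p q xs (λ y m → h y (there m)))

any-witness : ∀ (p : ℕ → Bool) xs → T (any p xs) → Σ ℕ (λ x → x ∈ xs × T (p x))
any-witness p xs t = find (any⁻ p xs t)

any-intro : ∀ (p : ℕ → Bool) {xs x} → x ∈ xs → T (p x) → T (any p xs)
any-intro p m t = any⁺ p (lose m t)

any-none : ∀ (p : ℕ → Bool) xs → (∀ x → x ∈ xs → T (p x) → ⊥) → any p xs ≡ false
any-none p xs h = ¬T⇒≡false (λ t → let (x , m , px) = any-witness p xs t in h x m px)

filterᵇ-cong-rng : ∀ k n (p q : ℕ → Bool) → (∀ x → InR k n x → p x ≡ q x) →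
                   filterᵇ p (rng k n) ≡ filterᵇ q (rng k n)
filterᵇ-cong-rng k n p q h = filterᵇ-cong p q _ (λ x m → h x (rng-∈⁻ m))


-- In  leftSubᵇ t k / rightSubᵇ t k  the nodes of t
-- carry the numbers k+1, …, k + nodes t; the root of  node L R  is
-- suc (k + nodes L), its left subtree occupies [k+1, k + nodes L] and its
-- right subtree [suc (k + nodes L) + 1, suc (k + nodes L) + nodes R].

root# : BinTree → ℕ → ℕ
root# L k = suc (k + nodes L)

last#-node : ∀ k L R → k + nodes (node L R) ≡ root# L k + nodes R
last#-node k L R = trans (+-suc k _) (cong suc (sym (+-assoc k (nodes L) (nodes R))))

left#≤last# : ∀ k L R → k + nodes L ≤ k + nodes (node L R)
left#≤last# k L R = +-monoʳ-≤ k (≤-trans (m≤m+n (nodes L) (nodes R)) (n≤1+n _))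

root#≤last# : ∀ k L R → root# L k ≤ k + nodes (node L R)
root#≤last# k L R = subst (root# L k ≤_) (sym (last#-node k L R)) (m≤m+n _ (nodes R))

data RightSubView (L R : BinTree) (k x y : ℕ) : Set where
  at-root  : y ≡ root# L k → InR (root# L k) (nodes R) x → RightSubView L R k x y
  in-left  : T (rightSubᵇ L k x y) → RightSubView L R k x y
  in-right : T (rightSubᵇ R (root# L k) x y) → RightSubView L R k x y

rightSub-view : ∀ L R k x y → T (rightSubᵇ (node L R) k x y) → RightSubView L R k x y
rightSub-view L R k x y h with T-∨⁻ ((y ≡ᵇ root# L k) ∧ inRangeᵇ x (suc (root# L k)) (root# L k + nodes R)) h
... | inj₁ h₁ with T-∧⁻ (y ≡ᵇ root# L k) h₁
...   | e , r = at-root (≡ᵇ⁻ e) (inRange⁻ r)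
rightSub-view L R k x y h | inj₂ h₂ with T-∨⁻ (rightSubᵇ L k x y) h₂
... | inj₁ hL = in-left hL
... | inj₂ hR = in-right hR

rightSub-root⁺ : ∀ L R k x → InR (root# L k) (nodes R) x → T (rightSubᵇ (node L R) k x (root# L k))
rightSub-root⁺ L R k x (a , b) = T-∨ˡ _ (T-∧⁺ (≡ᵇ⁺ {root# L k} refl) (inRange⁺ a b))

rightSub-left⁺ : ∀ L R k x y → T (rightSubᵇ L k x y) → T (rightSubᵇ (node L R) k x y)
rightSub-left⁺ L R k x y h = T-∨ʳ ((y ≡ᵇ root# L k) ∧ _) (T-∨ˡ (rightSubᵇ L k x y) h)

rightSub-right⁺ : ∀ L R k x y → T (rightSubᵇ R (root# L k) x y) → T (rightSubᵇ (node L R) k x y)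
rightSub-right⁺ L R k x y h = T-∨ʳ ((y ≡ᵇ root# L k) ∧ _) (T-∨ʳ (rightSubᵇ L k x y) h)

rightSub-support : ∀ t k x y → T (rightSubᵇ t k x y) → k < y × y < x × x ≤ k + nodes t
rightSub-support leaf k x y ()
rightSub-support (node L R) k x y h with rightSub-view L R k x y h
... | at-root refl (a , b) = s≤s (m≤m+n k (nodes L)) , a , subst (x ≤_) (sym (last#-node k L R)) b
... | in-left hL with rightSub-support L k x y hL
...   | a , b , c = a , b , ≤-trans c (left#≤last# k L R)
rightSub-support (node L R) k x y h | in-right hR with rightSub-support R (root# L k) x y hR
... | a , b , c = <-trans (s≤s (m≤m+n k (nodes L))) a , b , subst (x ≤_) (sym (last#-node k L R)) c

leftSub-support : ∀ t k x y → T (leftSubᵇ t k x y) → k < x × x < y × y ≤ k + nodes t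
leftSub-support leaf k x y ()
leftSub-support (node L R) k x y h with T-∨⁻ ((y ≡ᵇ root# L k) ∧ inRangeᵇ x (suc k) (k + nodes L)) h
... | inj₁ h₁ with T-∧⁻ (y ≡ᵇ root# L k) h₁
...   | e , r with ≡ᵇ⁻ {y} e | inRange⁻ {x} r
...     | refl | a , b = a , s≤s b , root#≤last# k L R
leftSub-support (node L R) k x y h | inj₂ h₂ with T-∨⁻ (leftSubᵇ L k x y) h₂
... | inj₁ hL with leftSub-support L k x y hL
...   | a , b , c = a , b , ≤-trans c (left#≤last# k L R)
leftSub-support (node L R) k x y h | inj₂ h₂ | inj₂ hR with leftSub-support R (root# L k) x y hR
... | a , b , c = <-trans (s≤s (m≤m+n k (nodes L))) a , b , subst (y ≤_) (sym (last#-node k L R)) c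

rightSub-inLeft : ∀ L R k x y → y ≤ k + nodes L → rightSubᵇ (node L R) k x y ≡ rightSubᵇ L k x y
rightSub-inLeft L R k x y hy = T-ext to (rightSub-left⁺ L R k x y)
  where
  to : T (rightSubᵇ (node L R) k x y) → T (rightSubᵇ L k x y)
  to h with rightSub-view L R k x y h
  ... | at-root refl _ = ⊥-elim (<-irrefl refl (s≤s hy))
  ... | in-left hL = hL
  ... | in-right hR = ⊥-elim (<⇒≱ (proj₁ (rightSub-support R _ x y hR)) (≤-trans hy (n≤1+n _)))

rightSub-inRight : ∀ L R k x y → root# L k < y → rightSubᵇ (node L R) k x y ≡ rightSubᵇ R (root# L k) x y
rightSub-inRight L R k x y hy = T-ext to (rightSub-right⁺ L R k x y)
  where
  to : T (rightSubᵇ (node L R) k x y) → T (rightSubᵇ R (root# L k) x y)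
  to h with rightSub-view L R k x y h
  ... | at-root refl _ = ⊥-elim (<-irrefl refl hy)
  ... | in-right hR = hR
  ... | in-left hL with rightSub-support L k x y hL
  ...   | _ , b , c = ⊥-elim (<⇒≱ b (≤-trans c (≤-trans (n≤1+n _) (<⇒≤ hy))))

rightSub-sourceInLeft : ∀ L R k x y → x ≤ k + nodes L → rightSubᵇ (node L R) k x y ≡ rightSubᵇ L k x y
rightSub-sourceInLeft L R k x y hx with y ≤? k + nodes L
... | yes hy = rightSub-inLeft L R k x y hy
... | no hy = trans (¬T⇒≡false (λ h → hy (below (rightSub-support (node L R) k x y h))))
                   (sym (¬T⇒≡false (λ h → hy (below (rightSub-support L k x y h)))))
  where
  below : ∀ {a b} → a < y × y < x × b → y ≤ k + nodes L
  below (_ , y<x , _) = ≤-trans (<⇒≤ y<x) hx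

rightSub-fromRoot : ∀ L R k y → T (rightSubᵇ (node L R) k (root# L k) y) → ⊥
rightSub-fromRoot L R k y h with rightSub-view L R k _ y h
... | at-root _ (a , _) = <-irrefl refl a
... | in-left hL = <-irrefl refl (proj₂ (proj₂ (rightSub-support L k _ y hL)))
... | in-right hR with rightSub-support R _ _ y hR
...   | a , b , _ = <-irrefl refl (<-trans a b)

rightSub-shift : ∀ j t k x y → rightSubᵇ t (j + k) (j + x) (j + y) ≡ rightSubᵇ t k x y
rightSub-shift zero    t k x y = refl
rightSub-shift (suc j) t k x y = trans (step t (j + k) (j + x) (j + y)) (rightSub-shift j t k x y)
  where
  step : ∀ t k x y → rightSubᵇ t (suc k) (suc x) (suc y) ≡ rightSubᵇ t k x y
  step leaf       k x y = refl
  step (node L R) k x y =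
    cong₂ _∨_ (cong ((y ≡ᵇ root# L k) ∧_) (cong ((root# L k <ᵇ x) ∧_) (≤ᵇ-suc x _)))
              (cong₂ _∨_ (step L k x y) (step R (root# L k) x y))

leftSub-shift : ∀ j t k x y → leftSubᵇ t (j + k) (j + x) (j + y) ≡ leftSubᵇ t k x y
leftSub-shift zero    t k x y = refl
leftSub-shift (suc j) t k x y = trans (step t (j + k) (j + x) (j + y)) (leftSub-shift j t k x y)
  where
  step : ∀ t k x y → leftSubᵇ t (suc k) (suc x) (suc y) ≡ leftSubᵇ t k x y
  step leaf       k x y = refl
  step (node L R) k x y =
    cong₂ _∨_ (cong ((y ≡ᵇ root# L k) ∧_) (cong ((k <ᵇ x) ∧_) (≤ᵇ-suc x _)))
              (cong₂ _∨_ (step L k x y) (step R (root# L k) x y))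

rightSub-shift₀ : ∀ j t x y → rightSubᵇ t j (j + x) (j + y) ≡ rightSubᵇ t 0 x y
rightSub-shift₀ j t x y = trans (cong (λ q → rightSubᵇ t q (j + x) (j + y)) (sym (+-identityʳ j))) (rightSub-shift j t 0 x y)

leftSub-shift₀ : ∀ j t x y → leftSubᵇ t j (j + x) (j + y) ≡ leftSubᵇ t 0 x y
leftSub-shift₀ j t x y = trans (cong (λ q → leftSubᵇ t q (j + x) (j + y)) (sym (+-identityʳ j))) (leftSub-shift j t 0 x y)

-- Left combs.  foldl node A [B₁, …, Bₘ] = node (… (node A B₁) …) Bₘ hangs
-- B₁, …, Bₘ as right subtrees along a left spine grown above A;
-- comb G = foldl node leaf G.  The lower tree of a grafting tree is a comb.

comb : List BinTree → BinTree
comb = foldl node leaf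

nodes-foldl : ∀ A G → nodes (foldl node A G) ≡ nodes A + nodes (comb G)
nodes-foldl A []      = sym (+-identityʳ _)
nodes-foldl A (B ∷ G) = begin
  nodes (foldl node (node A B) G)            ≡⟨ nodes-foldl (node A B) G ⟩
  suc (nodes A + nodes B) + nodes (comb G)   ≡⟨ cong suc (+-assoc (nodes A) (nodes B) _) ⟩
  suc (nodes A + (nodes B + nodes (comb G))) ≡⟨ sym (+-suc (nodes A) _) ⟩
  nodes A + (nodes (node leaf B) + nodes (comb G)) ≡⟨ cong (nodes A +_) (sym (nodes-foldl (node leaf B) G)) ⟩
  nodes A + nodes (comb (B ∷ G))             ∎
  where open ≡-Reasoning

offset-after : ∀ k A B → k + nodes (node A B) ≡ k + nodes A + nodes (node leaf B)
offset-after k A B = trans (+-suc k _) (trans (cong suc (sym (+-assoc k (nodes A) (nodes B)))) (sym (+-suc (k + nodes A) _)))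

rightSub-nodeLeaf : ∀ B o x y → rightSubᵇ (node leaf B) o x y ≡
  ((y ≡ᵇ suc o) ∧ inRangeᵇ x (suc (suc o)) (suc o + nodes B)) ∨ rightSubᵇ B (suc o) x y
rightSub-nodeLeaf B o x y = cong (λ z → ((y ≡ᵇ suc z) ∧ inRangeᵇ x (suc (suc z)) (suc z + nodes B)) ∨ rightSubᵇ B (suc z) x y) (+-identityʳ o)

∨-hoist : ∀ f a b c → (f ∨ (a ∨ b)) ∨ c ≡ a ∨ ((f ∨ b) ∨ c)
∨-hoist true  true  b c = refl
∨-hoist true  false b c = refl
∨-hoist false a     b c = ∨-assoc a b c

rightSub-foldl : ∀ A G k x y → rightSubᵇ (foldl node A G) k x y ≡ rightSubᵇ A k x y ∨ rightSubᵇ (comb G) (k + nodes A) x y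
rightSub-foldl A []      k x y = sym (∨-identityʳ _)
rightSub-foldl A (B ∷ G) k x y = begin
  rightSubᵇ (foldl node (node A B) G) k x y
    ≡⟨ rightSub-foldl (node A B) G k x y ⟩
  (atB ∨ (rightSubᵇ A k x y ∨ inB)) ∨ rest (k + nodes (node A B))
    ≡⟨ cong (λ o → (atB ∨ (rightSubᵇ A k x y ∨ inB)) ∨ rest o) (offset-after k A B) ⟩
  (atB ∨ (rightSubᵇ A k x y ∨ inB)) ∨ rest o′
    ≡⟨ ∨-hoist atB (rightSubᵇ A k x y) inB (rest o′) ⟩
  rightSubᵇ A k x y ∨ ((atB ∨ inB) ∨ rest o′)
    ≡⟨ cong (λ z → rightSubᵇ A k x y ∨ (z ∨ rest o′)) (sym (rightSub-nodeLeaf B (k + nodes A) x y)) ⟩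
  rightSubᵇ A k x y ∨ (rightSubᵇ (node leaf B) (k + nodes A) x y ∨ rest o′)
    ≡⟨ cong (rightSubᵇ A k x y ∨_) (sym (rightSub-foldl (node leaf B) G (k + nodes A) x y)) ⟩
  rightSubᵇ A k x y ∨ rightSubᵇ (comb (B ∷ G)) (k + nodes A) x y ∎
  where
  open ≡-Reasoning
  rest : ℕ → Bool
  rest o = rightSubᵇ (comb G) o x y
  o′ = k + nodes A + nodes (node leaf B)
  atB = (y ≡ᵇ root# A k) ∧ inRangeᵇ x (suc (root# A k)) (root# A k + nodes B)
  inB = rightSubᵇ B (root# A k) x y

spineLength : BinTree → ℕ
spineLength leaf       = 0
spineLength (node L R) = suc (spineLength L)

spineLength-comb : ∀ G → spineLength (comb G) ≡ length G
spineLength-comb G = go leaf G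
  where
  go : ∀ A G → spineLength (foldl node A G) ≡ spineLength A + length G
  go A []      = sym (+-identityʳ _)
  go A (B ∷ G) = trans (go (node A B) G) (sym (+-suc (spineLength A) (length G)))

spine : BinTree → ℕ → List ℕ
spine leaf       k = []
spine (node L R) k = spine L k ++ (root# L k ∷ [])

length-spine : ∀ t k → length (spine t k) ≡ spineLength t
length-spine leaf       k = refl
length-spine (node L R) k = trans (length-++ (spine L k)) (trans (+-comm _ 1) (cong suc (length-spine L k)))

spine-foldl : ∀ A G k → spine (foldl node A G) k ≡ spine A k ++ spine (comb G) (k + nodes A)
spine-foldl A []      k = sym (++-identityʳ _)
spine-foldl A (B ∷ G) k = begin
  spine (foldl node (node A B) G) k
    ≡⟨ spine-foldl (node A B) G k ⟩
  (spine A k ++ (root# A k ∷ [])) ++ spine (comb G) (k + nodes (node A B))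
    ≡⟨ ++-assoc (spine A k) _ _ ⟩
  spine A k ++ (root# A k ∷ spine (comb G) (k + nodes (node A B)))
    ≡⟨ cong₂ (λ z w → spine A k ++ (z ∷ spine (comb G) w)) (cong suc (sym (+-identityʳ _))) (offset-after k A B) ⟩
  spine A k ++ (spine (node leaf B) (k + nodes A) ++ spine (comb G) (k + nodes A + nodes (node leaf B)))
    ≡⟨ cong (spine A k ++_) (sym (spine-foldl (node leaf B) G (k + nodes A))) ⟩
  spine A k ++ spine (comb (B ∷ G)) (k + nodes A) ∎
  where open ≡-Reasoning

spine-∈ : ∀ t k z → z ∈ spine t k → InR k (nodes t) z
spine-∈ leaf       k z ()
spine-∈ (node L R) k z m with ∈-++⁻ (spine L k) m
... | inj₁ m₁ with spine-∈ L k z m₁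
...   | a , b = a , ≤-trans b (left#≤last# k L R)
spine-∈ (node L R) k z m | inj₂ (here refl) = s≤s (m≤m+n k (nodes L)) , root#≤last# k L R

-- rightArm t k b: the length of the left spine of the right subtree of
-- node b.  It will be the number of decreasing children of b.
rightArm : BinTree → ℕ → ℕ → ℕ
rightArm leaf       k b = 0
rightArm (node L R) k b =
  if b ≤ᵇ k + nodes L then rightArm L k b
  else if b ≡ᵇ root# L k then spineLength R
  else rightArm R (root# L k) b

rightArm-inLeft : ∀ L R k b → b ≤ k + nodes L → rightArm (node L R) k b ≡ rightArm L k b
rightArm-inLeft L R k b h rewrite T⇒≡true (≤⇒≤ᵇ h) = refl

rightArm-beyondLeft : ∀ L R k b → k + nodes L < b →
  rightArm (node L R) k b ≡ (if b ≡ᵇ root# L k then spineLength R else rightArm R (root# L k) b)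
rightArm-beyondLeft L R k b h rewrite ¬T⇒≡false (λ t → <⇒≱ h (≤ᵇ⁻ {b} t)) = refl

rightArm-atRoot : ∀ L R k → rightArm (node L R) k (root# L k) ≡ spineLength R
rightArm-atRoot L R k rewrite rightArm-beyondLeft L R k (root# L k) ≤-refl | T⇒≡true (≡ᵇ⁺ {root# L k} refl) = refl

rightArm-inRight : ∀ L R k b → root# L k < b → rightArm (node L R) k b ≡ rightArm R (root# L k) b
rightArm-inRight L R k b h rewrite rightArm-beyondLeft L R k b (<-trans (n<1+n _) h)
                                | ¬T⇒≡false (λ t → <-irrefl (sym (≡ᵇ⁻ {b} t)) h) = refl

rightArm-outside : ∀ t k b → k + nodes t < b → rightArm t k b ≡ 0
rightArm-outside leaf       k b h = refl
rightArm-outside (node L R) k b h = trans (rightArm-inRight L R k b (≤-<-trans (root#≤last# k L R) h))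
  (rightArm-outside R (root# L k) b (subst (_< b) (last#-node k L R) h))

rightArm-shift : ∀ j t k b → rightArm t (j + k) (j + b) ≡ rightArm t k b
rightArm-shift zero    t k b = refl
rightArm-shift (suc j) t k b = trans (step t (j + k) (j + b)) (rightArm-shift j t k b)
  where
  step : ∀ t k b → rightArm t (suc k) (suc b) ≡ rightArm t k b
  step leaf       k b = refl
  step (node L R) k b rewrite ≤ᵇ-suc b (k + nodes L) | step L k b | step R (root# L k) b = refl

rightArm-foldl-inside : ∀ A G k b → b ≤ k + nodes A → rightArm (foldl node A G) k b ≡ rightArm A k b
rightArm-foldl-inside A []      k b h = refl
rightArm-foldl-inside A (B ∷ G) k b h =
  trans (rightArm-foldl-inside (node A B) G k b (≤-trans h (left#≤last# k A B))) (rightArm-inLeft A B k b h)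

rightArm-foldl-after : ∀ A G k b → k + nodes A < b → rightArm (foldl node A G) k b ≡ rightArm (comb G) (k + nodes A) b
rightArm-foldl-after A []      k b h = rightArm-outside A k b h
rightArm-foldl-after A (B ∷ G) k b h with b ≤? k + nodes (node A B)
... | yes inAB = begin
  rightArm (foldl node (node A B) G) k b             ≡⟨ rightArm-foldl-inside (node A B) G k b inAB ⟩
  rightArm (node A B) k b                            ≡⟨ rightArm-beyondLeft A B k b h ⟩
  (if b ≡ᵇ suc o then spineLength B else rightArm B (suc o) b)
    ≡⟨ cong (λ z → if b ≡ᵇ suc z then spineLength B else rightArm B (suc z) b) (sym (+-identityʳ o)) ⟩
  (if b ≡ᵇ root# leaf o then spineLength B else rightArm B (root# leaf o) b)
    ≡⟨ sym (rightArm-beyondLeft leaf B o b (subst (_< b) (sym (+-identityʳ o)) h)) ⟩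
  rightArm (node leaf B) o b                         ≡⟨ sym (rightArm-foldl-inside (node leaf B) G o b inB) ⟩
  rightArm (comb (B ∷ G)) o b                        ∎
  where
  open ≡-Reasoning
  o = k + nodes A
  inB = subst (b ≤_) (offset-after k A B) inAB
... | no beyond = begin
  rightArm (foldl node (node A B) G) k b             ≡⟨ rightArm-foldl-after (node A B) G k b (≰⇒> beyond) ⟩
  rightArm (comb G) (k + nodes (node A B)) b         ≡⟨ cong (λ o → rightArm (comb G) o b) (offset-after k A B) ⟩
  rightArm (comb G) (k + nodes A + nodes (node leaf B)) b
    ≡⟨ sym (rightArm-foldl-after (node leaf B) G (k + nodes A) b (subst (_< b) (offset-after k A B) (≰⇒> beyond))) ⟩
  rightArm (comb (B ∷ G)) (k + nodes A) b            ∎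
  where open ≡-Reasoning

rightArm-foldl-node : ∀ A X D k b → root# A k < b →
  rightArm (foldl node (node A X) D) k b ≡ rightArm (foldl node X D) (root# A k) b
rightArm-foldl-node A X D k b h with b ≤? k + nodes (node A X)
... | yes inAX = begin
  rightArm (foldl node (node A X) D) k b  ≡⟨ rightArm-foldl-inside (node A X) D k b inAX ⟩
  rightArm (node A X) k b                ≡⟨ rightArm-inRight A X k b h ⟩
  rightArm X (root# A k) b               ≡⟨ sym (rightArm-foldl-inside X D (root# A k) b (subst (b ≤_) (last#-node k A X) inAX)) ⟩
  rightArm (foldl node X D) (root# A k) b ∎
  where open ≡-Reasoning
... | no beyond = begin
  rightArm (foldl node (node A X) D) k b      ≡⟨ rightArm-foldl-after (node A X) D k b (≰⇒> beyond) ⟩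
  rightArm (comb D) (k + nodes (node A X)) b  ≡⟨ cong (λ o → rightArm (comb D) o b) (last#-node k A X) ⟩
  rightArm (comb D) (root# A k + nodes X) b   ≡⟨ sym (rightArm-foldl-after X D (root# A k) b (subst (_< b) (last#-node k A X) (≰⇒> beyond))) ⟩
  rightArm (foldl node X D) (root# A k) b     ∎
  where open ≡-Reasoning

foldl-Rot : ∀ {A A′} D → Rot A A′ → Rot (foldl node A D) (foldl node A′ D)
foldl-Rot []      r = r
foldl-Rot (B ∷ D) r = foldl-Rot D (rot-left B r)

foldl-≤Tam : ∀ P Q D → foldl node (node P Q) D ≤Tam node P (foldl node Q D)
foldl-≤Tam P Q []      = ε
foldl-≤Tam P Q (B ∷ D) = foldl-Rot D (rot-here P Q B) ◅ foldl-≤Tam P (node Q B) D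

node-≤Tam : ∀ {A A′ B B′} → A ≤Tam A′ → B ≤Tam B′ → node A B ≤Tam node A′ B′
node-≤Tam {A′ = A′} {B = B} p q = gmap (λ z → node z B) (rot-left B) p ◅◅ gmap (node A′) (rot-right A′) q

-- Open and half-open intervals as ranges: rng b (c ∸ suc b) lists the
-- numbers strictly between b and c, rng b (n ∸ b) those in (b, n].

∈-between⁻ : ∀ {b c d} → d ∈ rng b (c ∸ suc b) → b < d × d < c
∈-between⁻ {b} {zero}      ()
∈-between⁻ {b} {suc c} {d} m with rng-∈⁻ {b} {c ∸ b} m | b ≤? c
... | b<d , d≤ | yes b≤c = b<d , s≤s (subst (d ≤_) (m+[n∸m]≡n b≤c) d≤)
... | b<d , d≤ | no  b≰c = ⊥-elim (<⇒≱ b<d (subst (d ≤_) (trans (cong (b +_) (m≤n⇒m∸n≡0 (≰⇒≥ b≰c))) (+-identityʳ b)) d≤))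

∈-between⁺ : ∀ {b c d} → b < d → d < c → d ∈ rng b (c ∸ suc b)
∈-between⁺ {b} {suc c} {d} b<d (s≤s d≤c) = rng-∈⁺ (b<d , subst (d ≤_) (sym (m+[n∸m]≡n (≤-trans (<⇒≤ b<d) d≤c))) d≤c)

∈-upTo⁻ : ∀ {b n c} → b ≤ n → c ∈ rng b (n ∸ b) → b < c × c ≤ n
∈-upTo⁻ {b} {n} {c} b≤n m with rng-∈⁻ m
... | b<c , c≤ = b<c , subst (c ≤_) (m+[n∸m]≡n b≤n) c≤

rng-split : ∀ b m n → b ≤ m → m ≤ n → rng b (n ∸ b) ≡ rng b (m ∸ b) ++ rng m (n ∸ m)
rng-split b m n b≤m m≤n = begin
  rng b (n ∸ b)                          ≡⟨ cong (rng b) lengths ⟩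
  rng b ((m ∸ b) + (n ∸ m))              ≡⟨ rng-+ b (m ∸ b) (n ∸ m) ⟩
  rng b (m ∸ b) ++ rng (b + (m ∸ b)) (n ∸ m) ≡⟨ cong (λ z → rng b (m ∸ b) ++ rng z (n ∸ m)) (m+[n∸m]≡n b≤m) ⟩
  rng b (m ∸ b) ++ rng m (n ∸ m)         ∎
  where
  open ≡-Reasoning
  lengths : n ∸ b ≡ (m ∸ b) + (n ∸ m)
  lengths = trans (cong (_∸ b) (sym (m∸n+n≡m m≤n))) (trans (+-∸-assoc (n ∸ m) b≤m) (+-comm (n ∸ m) (m ∸ b)))

rng-node : ∀ k L R → rng k (nodes (node L R)) ≡ rng k (nodes L) ++ (root# L k ∷ rng (root# L k) (nodes R))
rng-node k L R = trans (cong (rng k) (sym (+-suc (nodes L) (nodes R)))) (rng-+ k (nodes L) (suc (nodes R)))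

isTop : BinTree → ℕ → ℕ → Bool
isTop t k e = not (any (λ d → rightSubᵇ t k e d) (rng k (e ∸ suc k)))

tops≡spine : ∀ t k → filterᵇ (isTop t k) (rng k (nodes t)) ≡ spine t k
tops≡spine leaf       k = refl
tops≡spine (node L R) k = begin
  filterᵇ top (rng k (nodes (node L R)))
    ≡⟨ cong (filterᵇ top) (rng-node k L R) ⟩
  filterᵇ top (rng k (nodes L) ++ (r ∷ rng r (nodes R)))
    ≡⟨ filter-++ (λ x → T? (top x)) (rng k (nodes L)) _ ⟩
  filterᵇ top (rng k (nodes L)) ++ filterᵇ top (r ∷ rng r (nodes R))
    ≡⟨ cong₂ _++_ (filterᵇ-cong-rng k (nodes L) top (isTop L k) topInL) (filter-accept (λ x → T? (top x)) rootIsTop) ⟩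
  filterᵇ (isTop L k) (rng k (nodes L)) ++ (r ∷ filterᵇ top (rng r (nodes R)))
    ≡⟨ cong₂ (λ u v → u ++ (r ∷ v)) (tops≡spine L k) (filterᵇ-none top _ noTopInR) ⟩
  spine L k ++ (r ∷ []) ∎
  where
  open ≡-Reasoning
  r = root# L k
  top = isTop (node L R) k
  topInL : ∀ e → InR k (nodes L) e → top e ≡ isTop L k e
  topInL e (_ , e≤) = cong not (any-cong _ _ (rng k (e ∸ suc k)) (λ d _ → rightSub-sourceInLeft L R k e d e≤))
  rootIsTop : T (top r)
  rootIsTop = Equivalence.from T-not-≡ (any-none (rightSubᵇ (node L R) k r) (rng k (r ∸ suc k)) (λ d _ → rightSub-fromRoot L R k d))
  noTopInR : ∀ e → e ∈ rng r (nodes R) → T (top e) → ⊥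
  noTopInR e m t with rng-∈⁻ m
  ... | inR = T-not⁻ t (any-intro (rightSubᵇ (node L R) k e) (∈-between⁺ (s≤s (m≤m+n k (nodes L))) (proj₁ inR)) (rightSub-root⁺ L R k e inR))

below-spine : ∀ t k e → InR k (nodes t) e → Σ ℕ (λ z → z ∈ spine t k × (e ≡ z ⊎ T (rightSubᵇ t k e z)))
below-spine leaf       k e (a , b) = ⊥-elim (<⇒≱ a (subst (e ≤_) (+-identityʳ k) b))
below-spine (node L R) k e (a , b) with <-cmp e (root# L k)
... | tri< lt _ _ with below-spine L k e (a , ≤-pred lt)
...   | z , m , inj₁ eq = z , ∈-++⁺ˡ m , inj₁ eq
...   | z , m , inj₂ h  = z , ∈-++⁺ˡ m , inj₂ (rightSub-left⁺ L R k e z h)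
below-spine (node L R) k e (a , b) | tri≈ _ eq _ = root# L k , ∈-++⁺ʳ (spine L k) (here refl) , inj₁ eq
below-spine (node L R) k e (a , b) | tri> _ _ gt = root# L k , ∈-++⁺ʳ (spine L k) (here refl) ,
  inj₂ (rightSub-root⁺ L R k e (gt , subst (e ≤_) (last#-node k L R) b))

coveredBy : BinTree → ℕ → ℕ → ℕ → Bool
coveredBy t k b c = rightSubᵇ t k c b ∧ not (any (λ d → rightSubᵇ t k c d ∧ rightSubᵇ t k d b) (rng b (c ∸ suc b)))

coveredCount : BinTree → ℕ → ℕ → ℕ
coveredCount t k b = length (filterᵇ (coveredBy t k b) (rng b (k + nodes t ∸ b)))

count-covered-inLeft : ∀ L R k b → b ≤ k + nodes L → coveredCount L k b ≡ rightArm L k b →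
                       coveredCount (node L R) k b ≡ rightArm (node L R) k b
count-covered-inLeft L R k b b≤L countL = begin
  length (filterᵇ cov (rng b (n ∸ b)))
    ≡⟨ cong (λ xs → length (filterᵇ cov xs)) (rng-split b (k + nodes L) n b≤L (left#≤last# k L R)) ⟩
  length (filterᵇ cov (rng b (k + nodes L ∸ b) ++ rng (k + nodes L) (n ∸ (k + nodes L))))
    ≡⟨ cong length (filter-++ (λ x → T? (cov x)) (rng b (k + nodes L ∸ b)) _) ⟩
  length (filterᵇ cov (rng b (k + nodes L ∸ b)) ++ filterᵇ cov (rng (k + nodes L) (n ∸ (k + nodes L))))
    ≡⟨ length-++ (filterᵇ cov (rng b (k + nodes L ∸ b))) ⟩
  length (filterᵇ cov (rng b (k + nodes L ∸ b))) + length (filterᵇ cov (rng (k + nodes L) (n ∸ (k + nodes L))))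
    ≡⟨ cong₂ _+_ (cong length (filterᵇ-cong _ _ _ sameAsL)) (cong length (filterᵇ-none _ _ noneBeyondL)) ⟩
  length (filterᵇ (coveredBy L k b) (rng b (k + nodes L ∸ b))) + 0
    ≡⟨ trans (+-identityʳ _) countL ⟩
  rightArm L k b
    ≡⟨ sym (rightArm-inLeft L R k b b≤L) ⟩
  rightArm (node L R) k b ∎
  where
  open ≡-Reasoning
  n = k + nodes (node L R)
  cov = coveredBy (node L R) k b
  sameAsL : ∀ c → c ∈ rng b (k + nodes L ∸ b) → cov c ≡ coveredBy L k b c
  sameAsL c m with ∈-upTo⁻ b≤L m
  ... | b<c , c≤L = cong₂ _∧_ (rightSub-sourceInLeft L R k c b c≤L) (cong not (any-cong _ _ (rng b (c ∸ suc b))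
        λ d md → let (_ , d<c) = ∈-between⁻ md in
                 cong₂ _∧_ (rightSub-sourceInLeft L R k c d c≤L) (rightSub-sourceInLeft L R k d b (≤-trans (<⇒≤ d<c) c≤L))))
  noneBeyondL : ∀ c → c ∈ rng (k + nodes L) (n ∸ (k + nodes L)) → T (cov c) → ⊥
  noneBeyondL c m t = <⇒≱ (proj₁ (rng-∈⁻ m)) (proj₂ (proj₂ (rightSub-support L k c b
    (subst T (rightSub-inLeft L R k c b b≤L) (proj₁ (T-∧⁻ (rightSubᵇ (node L R) k c b) t))))))

-- The nodes covered by the root are the tops of its right subtree.
count-covered-atRoot : ∀ L R k → coveredCount (node L R) k (root# L k) ≡ rightArm (node L R) k (root# L k)
count-covered-atRoot L R k = begin
  length (filterᵇ cov (rng r (k + nodes (node L R) ∸ r)))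
    ≡⟨ cong (λ z → length (filterᵇ cov (rng r z))) (trans (cong (_∸ r) (last#-node k L R)) (m+n∸m≡n r (nodes R))) ⟩
  length (filterᵇ cov (rng r (nodes R)))
    ≡⟨ cong length (filterᵇ-cong-rng r (nodes R) cov (isTop R r) coveredIsTop) ⟩
  length (filterᵇ (isTop R r) (rng r (nodes R)))
    ≡⟨ cong length (tops≡spine R r) ⟩
  length (spine R r)
    ≡⟨ length-spine R r ⟩
  spineLength R
    ≡⟨ sym (rightArm-atRoot L R k) ⟩
  rightArm (node L R) k r ∎
  where
  open ≡-Reasoning
  r = root# L k
  cov = coveredBy (node L R) k r
  coveredIsTop : ∀ c → InR r (nodes R) c → cov c ≡ isTop R r c
  coveredIsTop c inR@(r<c , c≤) = cong₂ _∧_ (T⇒≡true (rightSub-root⁺ L R k c inR)) (cong not (any-cong _ _ (rng r (c ∸ suc r))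
    λ d md → let (r<d , d<c) = ∈-between⁻ md in
             trans (cong₂ _∧_ (rightSub-inRight L R k c d r<d) (T⇒≡true (rightSub-root⁺ L R k d (r<d , ≤-trans (<⇒≤ d<c) c≤))))
                   (∧-identityʳ _)))

count-covered-inRight : ∀ L R k b → root# L k < b → coveredCount R (root# L k) b ≡ rightArm R (root# L k) b →
                        coveredCount (node L R) k b ≡ rightArm (node L R) k b
count-covered-inRight L R k b gt countR = begin
  length (filterᵇ cov (rng b (k + nodes (node L R) ∸ b)))
    ≡⟨ cong (λ z → length (filterᵇ cov (rng b (z ∸ b)))) (last#-node k L R) ⟩
  length (filterᵇ cov (rng b (r + nodes R ∸ b)))
    ≡⟨ cong length (filterᵇ-cong _ _ _ sameAsR) ⟩
  length (filterᵇ (coveredBy R r b) (rng b (r + nodes R ∸ b)))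
    ≡⟨ countR ⟩
  rightArm R r b
    ≡⟨ sym (rightArm-inRight L R k b gt) ⟩
  rightArm (node L R) k b ∎
  where
  open ≡-Reasoning
  r = root# L k
  cov = coveredBy (node L R) k b
  sameAsR : ∀ c → c ∈ rng b (r + nodes R ∸ b) → cov c ≡ coveredBy R r b c
  sameAsR c _ = cong₂ _∧_ (rightSub-inRight L R k c b gt) (cong not (any-cong _ _ (rng b (c ∸ suc b))
    λ d md → cong₂ _∧_ (rightSub-inRight L R k c d (<-trans gt (proj₁ (∈-between⁻ {c = c} md)))) (rightSub-inRight L R k d b gt)))

count-covered : ∀ t k b → k < b → b ≤ k + nodes t → coveredCount t k b ≡ rightArm t k b
count-covered leaf       k b k<b b≤ = ⊥-elim (<⇒≱ k<b (subst (b ≤_) (+-identityʳ k) b≤))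
count-covered (node L R) k b k<b b≤ with <-cmp b (root# L k)
... | tri< lt _ _  = count-covered-inLeft L R k b (≤-pred lt) (count-covered L k b k<b (≤-pred lt))
... | tri≈ _ refl _ = count-covered-atRoot L R k
... | tri> _ _ gt  = count-covered-inRight L R k b gt (count-covered R (root# L k) b gt (subst (b ≤_) (last#-node k L R) b≤))

BRel : Set
BRel = ℕ → ℕ → Bool

IsTransitive : BRel → Set
IsTransitive S = ∀ x y z → T (S x y) → T (S y z) → T (S x z)

module _ (R : BRel) where
  R⊆warshall : ∀ N x y → T (R x y) → T (warshall N R x y)
  R⊆warshall zero    x y h = h
  R⊆warshall (suc N) x y h = T-∨ˡ (warshall N R x y) (R⊆warshall N x y h)

  warshall-mono : ∀ i N x y → T (warshall N R x y) → T (warshall (i + N) R x y)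
  warshall-mono zero    N x y h = h
  warshall-mono (suc i) N x y h = T-∨ˡ (warshall (i + N) R x y) (warshall-mono i N x y h)

  warshall-path : ∀ N m x y → 1 ≤ m → m ≤ N → T (R x m) → T (R m y) → T (warshall N R x y)
  warshall-path N (suc m) x y _ m≤N a b = subst (λ z → T (warshall z R x y)) (m∸n+n≡m m≤N)
    (warshall-mono (N ∸ suc m) (suc m) x y
      (T-∨ʳ (warshall m R x y) (T-∧⁺ (R⊆warshall m x (suc m) a) (R⊆warshall m (suc m) y b))))

  warshall⊆ : ∀ (S : BRel) → (∀ x y → T (R x y) → T (S x y)) → IsTransitive S →
              ∀ N x y → T (warshall N R x y) → T (S x y)
  warshall⊆ S R⊆S trans-S zero    x y h = R⊆S x y h
  warshall⊆ S R⊆S trans-S (suc N) x y h with T-∨⁻ (warshall N R x y) h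
  ... | inj₁ h₁ = warshall⊆ S R⊆S trans-S N x y h₁
  ... | inj₂ h₂ with T-∧⁻ (warshall N R x (suc N)) h₂
  ...   | a , b = trans-S x (suc N) y (warshall⊆ S R⊆S trans-S N x (suc N) a) (warshall⊆ S R⊆S trans-S N (suc N) y b)

  warshall-char : ∀ (S : BRel) N → (∀ x y → T (R x y) → T (S x y)) → IsTransitive S →
    (∀ x y → T (S x y) → T (R x y) ⊎ Σ ℕ (λ m → 1 ≤ m × m ≤ N × T (R x m) × T (R m y))) →
    ∀ x y → warshall N R x y ≡ S x y
  warshall-char S N R⊆S trans-S S⊆path x y = T-ext (warshall⊆ S R⊆S trans-S N x y) back
    where
    back : T (S x y) → T (warshall N R x y)
    back h with S⊆path x y h
    ... | inj₁ r                     = R⊆warshall N x y r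
    ... | inj₂ (m , m≥1 , m≤N , a , b) = warshall-path N m x y m≥1 m≤N a b

module _ (T₁ T₂ : BinTree) where
  IP-refl : ∀ x → rel (IP T₁ T₂) x x ≡ inRangeᵇ x 1 (nodes T₂)
  IP-refl x rewrite T⇒≡true (≡ᵇ⁺ {x} refl) = refl

  IP-inc : ∀ x y → x < y → rel (IP T₁ T₂) x y ≡ leftSubᵇ T₂ 0 x y
  IP-inc x y lt rewrite ¬T⇒≡false (λ t → <-irrefl (≡ᵇ⁻ {x} t) lt) | T⇒≡true (<⇒<ᵇ lt) = refl

  IP-dec : ∀ x y → y < x → rel (IP T₁ T₂) x y ≡ rightSubᵇ T₁ 0 x y
  IP-dec x y lt rewrite ¬T⇒≡false (λ t → <-irrefl (sym (≡ᵇ⁻ {x} t)) lt)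
                      | ¬T⇒≡false (λ t → <-asym lt (<ᵇ⇒< x y t)) = refl

  data IPView (x y : ℕ) : Set where
    ip-refl : x ≡ y → T (inRangeᵇ x 1 (nodes T₂)) → IPView x y
    ip-inc  : x < y → T (leftSubᵇ T₂ 0 x y) → IPView x y
    ip-dec  : y < x → T (rightSubᵇ T₁ 0 x y) → IPView x y

  ip-view : ∀ x y → T (rel (IP T₁ T₂) x y) → IPView x y
  ip-view x y h with <-cmp x y
  ... | tri< lt _ _   = ip-inc lt (subst T (IP-inc x y lt) h)
  ... | tri≈ _ refl _ = ip-refl refl (subst T (IP-refl x) h)
  ... | tri> _ _ gt   = ip-dec gt (subst T (IP-dec x y gt) h)

  ip-intro : ∀ x y → IPView x y → T (rel (IP T₁ T₂) x y)
  ip-intro x y (ip-refl refl h) = subst T (sym (IP-refl x)) h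
  ip-intro x y (ip-inc lt h)    = subst T (sym (IP-inc x y lt)) h
  ip-intro x y (ip-dec lt h)    = subst T (sym (IP-dec x y lt)) h

  IP-support : nodes T₁ ≡ nodes T₂ → ∀ x y → T (rel (IP T₁ T₂) x y) →
               (1 ≤ x × x ≤ nodes T₂) × (1 ≤ y × y ≤ nodes T₂)
  IP-support e x y h with ip-view x y h
  ... | ip-refl refl r = inRange⁻ {x} r , inRange⁻ {x} r
  ... | ip-inc lt r with leftSub-support T₂ 0 x y r
  ...   | a , b , c = (a , ≤-trans (<⇒≤ b) c) , (≤-trans a (<⇒≤ b) , c)
  IP-support e x y h | ip-dec lt r with rightSub-support T₁ 0 x y r
  ... | a , b , c = (≤-trans a (<⇒≤ b) , subst (x ≤_) e c) , (a , subst (y ≤_) e (≤-trans (<⇒≤ b) c))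

coveredIn : BRel → ℕ → ℕ → Bool
coveredIn r b c = r c b ∧ not (any (λ d → r c d ∧ r d b) (rng b (c ∸ suc b)))

decChildren-rng : ∀ I b → decChildren I b ≡ length (filterᵇ (coveredIn (rel I) b) (rng b (size I ∸ b)))
decChildren-rng I b = cong length (trans (cong (filterᵇ covered) (range≡rng b (size I ∸ b)))
  (filterᵇ-cong covered (coveredIn (rel I) b) (rng b (size I ∸ b))
    λ c _ → cong (λ l → rel I c b ∧ not (any (λ d → rel I c d ∧ rel I d b) l)) (range≡rng b (c ∸ suc b))))
  where
  covered : ℕ → Bool
  covered c = rel I c b ∧ not (any (λ d → rel I c d ∧ rel I d b) (range b (c ∸ suc b)))

decChildren-cong : ∀ I J b → I ≅ J → 1 ≤ b → b ≤ size I → decChildren I b ≡ decChildren J b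
decChildren-cong I J b (eqS , eqR) b≥1 b≤n = begin
  decChildren I b                                                   ≡⟨ decChildren-rng I b ⟩
  length (filterᵇ (coveredIn (rel I) b) (rng b (size I ∸ b)))       ≡⟨ cong length (filterᵇ-cong _ _ _ same) ⟩
  length (filterᵇ (coveredIn (rel J) b) (rng b (size I ∸ b)))       ≡⟨ cong (λ z → length (filterᵇ (coveredIn (rel J) b) (rng b (z ∸ b)))) eqS ⟩
  length (filterᵇ (coveredIn (rel J) b) (rng b (size J ∸ b)))       ≡⟨ sym (decChildren-rng J b) ⟩
  decChildren J b ∎
  where
  open ≡-Reasoning
  same : ∀ c → c ∈ rng b (size I ∸ b) → coveredIn (rel I) b c ≡ coveredIn (rel J) b c
  same c m with ∈-upTo⁻ b≤n m
  ... | b<c , c≤n = cong₂ _∧_ (eqR c b c≥1 c≤n b≥1 b≤n) (cong not (any-cong _ _ (rng b (c ∸ suc b))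
        λ d md → let (b<d , d<c) = ∈-between⁻ md
                     d≥1 = ≤-trans b≥1 (<⇒≤ b<d)
                     d≤n = ≤-trans (<⇒≤ d<c) c≤n
                 in cong₂ _∧_ (eqR c d c≥1 c≤n d≥1 d≤n) (eqR d b d≥1 d≤n b≥1 b≤n)))
    where c≥1 = ≤-trans b≥1 (<⇒≤ b<c)

decChildren-IP : ∀ T₁ T₂ b → nodes T₁ ≡ nodes T₂ → 1 ≤ b → b ≤ nodes T₂ → decChildren (IP T₁ T₂) b ≡ rightArm T₁ 0 b
decChildren-IP T₁ T₂ b e b≥1 b≤n = begin
  decChildren (IP T₁ T₂) b
    ≡⟨ decChildren-rng (IP T₁ T₂) b ⟩
  length (filterᵇ (coveredIn (rel (IP T₁ T₂)) b) (rng b (nodes T₂ ∸ b)))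
    ≡⟨ cong length (filterᵇ-cong _ _ _ same) ⟩
  length (filterᵇ (coveredBy T₁ 0 b) (rng b (nodes T₂ ∸ b)))
    ≡⟨ cong (λ z → length (filterᵇ (coveredBy T₁ 0 b) (rng b (z ∸ b)))) (sym e) ⟩
  length (filterᵇ (coveredBy T₁ 0 b) (rng b (nodes T₁ ∸ b)))
    ≡⟨ count-covered T₁ 0 b b≥1 (subst (b ≤_) (sym e) b≤n) ⟩
  rightArm T₁ 0 b ∎
  where
  open ≡-Reasoning
  same : ∀ c → c ∈ rng b (nodes T₂ ∸ b) → coveredIn (rel (IP T₁ T₂)) b c ≡ coveredBy T₁ 0 b c
  same c m = cong₂ _∧_ (IP-dec T₁ T₂ c b b<c) (cong not (any-cong _ _ (rng b (c ∸ suc b))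
    λ d md → let (b<d , d<c) = ∈-between⁻ md in cong₂ _∧_ (IP-dec T₁ T₂ c d d<c) (IP-dec T₁ T₂ d b b<d)))
    where b<c = proj₁ (∈-upTo⁻ b≤n m)

decRoots-IP : ∀ (J : IPos) T₁ T₂ → size J ≡ nodes T₁ → (∀ x y → rel J x y ≡ rel (IP T₁ T₂) x y) →
              decRoots J ≡ spine T₁ 0
decRoots-IP J T₁ T₂ eqS eqR = begin
  filterᵇ root (range 0 (size J))     ≡⟨ cong (filterᵇ root) (range≡rng 0 (size J)) ⟩
  filterᵇ root (rng 0 (size J))       ≡⟨ filterᵇ-cong _ _ (rng 0 (size J)) (λ b _ → rootIsTop b) ⟩
  filterᵇ (isTop T₁ 0) (rng 0 (size J)) ≡⟨ cong (λ n → filterᵇ (isTop T₁ 0) (rng 0 n)) eqS ⟩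
  filterᵇ (isTop T₁ 0) (rng 0 (nodes T₁)) ≡⟨ tops≡spine T₁ 0 ⟩
  spine T₁ 0 ∎
  where
  open ≡-Reasoning
  root : ℕ → Bool
  root b = not (any (λ a → rel J b a) (range 0 (b ∸ 1)))
  rootIsTop : ∀ b → root b ≡ isTop T₁ 0 b
  rootIsTop b = cong not (trans (cong (any (rel J b)) (range≡rng 0 (b ∸ 1)))
    (any-cong _ _ (rng 0 (b ∸ 1)) λ a m → trans (eqR b a) (IP-dec T₁ T₂ b a (proj₂ (∈-between⁻ {c = b} m)))))

-- Right grafting onto u.  In  u ≻_r J  the closure only adds, for each
-- vertex x of the shifted J lying below one of the r selected decreasing
-- roots, the relation x ◁ 1.

selected : IPos → ℕ → List ℕ
selected J r = take r (map (1 +_) (decRoots J))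

shift₁ : BRel → BRel
shift₁ = shiftRel 1

shift₁⁻ : ∀ (R : BRel) a b → T (shift₁ R a b) → Σ ℕ λ a′ → Σ ℕ λ b′ →
          a ≡ suc a′ × b ≡ suc b′ × 1 ≤ a′ × 1 ≤ b′ × T (R a′ b′)
shift₁⁻ R a b h with T-∧⁻ (1 <ᵇ a) h
... | h₁ , h₂ with T-∧⁻ (1 <ᵇ b) h₂
...   | h₃ , h₄ with <ᵇ⇒< 1 a h₁ | <ᵇ⇒< 1 b h₃
...     | s≤s a′≥1 | s≤s b′≥1 = _ , _ , refl , refl , a′≥1 , b′≥1 , h₄

shift₁⁺ : ∀ (R : BRel) a b → 1 ≤ a → 1 ≤ b → T (R a b) → T (shift₁ R (suc a) (suc b))
shift₁⁺ R a b a≥1 b≥1 h = T-∧⁺ (<⇒<ᵇ (s≤s a≥1)) (T-∧⁺ (<⇒<ᵇ (s≤s b≥1)) h)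

shift₁-trans : ∀ R → IsTransitive R → IsTransitive (shift₁ R)
shift₁-trans R trans-R a b c h₁ h₂ with shift₁⁻ R a b h₁ | shift₁⁻ R b c h₂
... | a′ , b′ , refl , refl , a′≥1 , _ , r₁ | _ , c′ , refl , refl , _ , c′≥1 , r₂ =
  shift₁⁺ R a′ c′ a′≥1 c′≥1 (trans-R a′ b′ c′ r₁ r₂)

module RightGraftU (J : IPos) (r : ℕ) (trans-J : IsTransitive (rel J))
  (selected-ok : ∀ z → z ∈ selected J r → Σ ℕ λ z′ → z ≡ suc z′ × 1 ≤ z′ × z′ ≤ size J × T (rel J z′ z′)) where

  private
    m = size J
    Jₛ = shift₁ (rel J)
    S = selected J r
    base : BRel
    base x y = concatRel uIP J x y ∨ ((y ≡ᵇ 1) ∧ any (λ z → x ≡ᵇ z) S)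

  graftedRel : BRel
  graftedRel x y = concatRel uIP J x y ∨ ((y ≡ᵇ 1) ∧ any (Jₛ x) S)

  data GraftedView (x y : ℕ) : Set where
    at-u    : x ≡ 1 → y ≡ 1 → GraftedView x y
    in-J    : T (Jₛ x y) → GraftedView x y
    grafted : y ≡ 1 → T (any (Jₛ x) S) → GraftedView x y

  grafted-view : ∀ x y → T (graftedRel x y) → GraftedView x y
  grafted-view x y h with T-∨⁻ (concatRel uIP J x y) h
  ... | inj₂ h₂ with T-∧⁻ (y ≡ᵇ 1) h₂
  ...   | y≡1 , below = grafted (≡ᵇ⁻ y≡1) below
  grafted-view x y h | inj₁ h₁ with T-∨⁻ (rel uIP x y) h₁
  ... | inj₂ j = in-J j
  ... | inj₁ i with T-∧⁻ (x ≡ᵇ 1) i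
  ...   | x≡1 , y≡1 = at-u (≡ᵇ⁻ x≡1) (≡ᵇ⁻ y≡1)

  grafted-intro : ∀ x y → GraftedView x y → T (graftedRel x y)
  grafted-intro x y (at-u refl refl)   = tt
  grafted-intro x y (in-J j)           = T-∨ˡ (concatRel uIP J x y) (T-∨ʳ (rel uIP x y) j)
  grafted-intro x y (grafted refl h)   = T-∨ʳ (concatRel uIP J x 1) (T-∧⁺ {1 ≡ᵇ 1} tt h)

  Jₛ-from-1 : ∀ c → T (Jₛ 1 c) → ⊥
  Jₛ-from-1 c ()

  grafted-trans : IsTransitive graftedRel
  grafted-trans a b c h₁ h₂ with grafted-view a b h₁
  ... | at-u refl refl = h₂
  ... | in-J j₁ with grafted-view b c h₂
  ...   | at-u refl refl = ⊥-elim (proj₂ (T-∧⁻ (1 <ᵇ a) j₁))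
  ...   | in-J j₂        = grafted-intro a c (in-J (shift₁-trans (rel J) trans-J a b c j₁ j₂))
  ...   | grafted refl below with any-witness (Jₛ b) S below
  ...     | z , z∈S , j₂ = grafted-intro a 1 (grafted refl (any-intro (Jₛ a) z∈S (shift₁-trans (rel J) trans-J a b z j₁ j₂)))
  grafted-trans a b c h₁ h₂ | grafted refl below with grafted-view 1 c h₂
  ... | at-u _ refl   = grafted-intro a 1 (grafted refl below)
  ... | in-J j₂       = ⊥-elim (Jₛ-from-1 c j₂)
  ... | grafted refl _ = grafted-intro a 1 (grafted refl below)

  private
    base⊆grafted : ∀ x y → T (base x y) → T (graftedRel x y)
    base⊆grafted x y h with T-∨⁻ (concatRel uIP J x y) h
    ... | inj₁ h₁ = T-∨ˡ (concatRel uIP J x y) h₁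
    ... | inj₂ h₂ with T-∧⁻ (y ≡ᵇ 1) h₂
    ...   | y≡1 , isSel with any-witness (λ z → x ≡ᵇ z) S isSel
    ...     | z , z∈S , x≡z with ≡ᵇ⁻ {x} x≡z | selected-ok z z∈S
    ...       | refl | z′ , refl , z′≥1 , _ , refl-z′ =
      T-∨ʳ (concatRel uIP J x y) (T-∧⁺ y≡1 (any-intro (Jₛ x) z∈S (shift₁⁺ (rel J) z′ z′ z′≥1 z′≥1 refl-z′)))

    grafted-path : ∀ x y → T (graftedRel x y) →
      T (base x y) ⊎ Σ ℕ (λ k → 1 ≤ k × k ≤ 1 + m × T (base x k) × T (base k y))
    grafted-path x y h with T-∨⁻ (concatRel uIP J x y) h
    ... | inj₁ h₁ = inj₁ (T-∨ˡ (concatRel uIP J x y) h₁)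
    ... | inj₂ h₂ with T-∧⁻ (y ≡ᵇ 1) h₂
    ...   | y≡1 , below with any-witness (Jₛ x) S below
    ...     | z , z∈S , jz with selected-ok z z∈S
    ...       | z′ , refl , _ , z′≤m , _ = inj₂ (suc z′ , s≤s z≤n , s≤s z′≤m ,
                T-∨ˡ (concatRel uIP J x (suc z′)) (T-∨ʳ (rel uIP x (suc z′)) jz) ,
                T-∨ʳ (concatRel uIP J (suc z′) y) (T-∧⁺ y≡1 (any-intro (λ w → suc z′ ≡ᵇ w) z∈S (≡ᵇ⁺ {suc z′} refl))))

  rightGraftU-rel : ∀ x y → rel (rightGraft uIP r J) x y ≡ graftedRel x y
  rightGraftU-rel = warshall-char base graftedRel (1 + m) base⊆grafted grafted-trans grafted-path

-- Left grafting.  In  A ≺ K  the closure adds exactly the relations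
-- x ◁ y with x a vertex of A and y a vertex of the shifted K above its
-- first vertex.

suc+∸ : ∀ p a → suc p + a ∸ p ≡ suc a
suc+∸ p a = trans (cong (_∸ p) (sym (+-suc p a))) (m+n∸m≡n p (suc a))

suc∸ : ∀ p → suc p ∸ p ≡ 1
suc∸ p = trans (+-∸-assoc 1 (≤-refl {p})) (cong suc (n∸n≡0 p))

beyond : ∀ p x → p < x → Σ ℕ λ a → x ≡ suc p + a
beyond p x p<x = x ∸ suc p , sym (m+[n∸m]≡n p<x)

positive : ∀ q a → q < q + a → 1 ≤ a
positive q zero    h = ⊥-elim (<-irrefl (sym (+-identityʳ q)) h)
positive q (suc a) h = s≤s z≤n

module LeftGraft (A K : IPos) (trans-A : IsTransitive (rel A)) (trans-K : IsTransitive (rel K))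
  (support-A : ∀ x y → T (rel A x y) → (1 ≤ x × x ≤ size A) × (1 ≤ y × y ≤ size A))
  (K-nonempty : T (0 <ᵇ size K)) (refl-K₁ : T (rel K 1 1)) where

  private
    p = size A
    base : BRel
    base x y = concatRel A K x y ∨ ((0 <ᵇ size K) ∧ inRangeᵇ x 1 p ∧ (y ≡ᵇ suc p))

  graftedRel : BRel
  graftedRel x y = concatRel A K x y ∨ (inRangeᵇ x 1 p ∧ shiftRel p (rel K) (suc p) y)

  data GraftedView (x y : ℕ) : Set where
    in-A    : T (rel A x y) → GraftedView x y
    in-K    : ∀ a b → x ≡ suc p + a → y ≡ suc p + b → T (rel K (suc a) (suc b)) → GraftedView x y
    grafted : 1 ≤ x → x ≤ p → ∀ b → y ≡ suc p + b → T (rel K 1 (suc b)) → GraftedView x y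

  private
    split-beyond : ∀ x → T (p <ᵇ x) → x ∸ p ≡ suc (x ∸ suc p) × x ≡ suc p + (x ∸ suc p)
    split-beyond x t = trans (cong (_∸ p) e) (suc+∸ p (x ∸ suc p)) , e
      where e = proj₂ (beyond p x (<ᵇ⇒< p x t))

  grafted-view : ∀ x y → T (graftedRel x y) → GraftedView x y
  grafted-view x y h with T-∨⁻ (concatRel A K x y) h
  ... | inj₁ h₁ with T-∨⁻ (rel A x y) h₁
  ...   | inj₁ a = in-A a
  ...   | inj₂ k with T-∧⁻ (p <ᵇ x) k
  ...     | x>p , k₁ with T-∧⁻ (p <ᵇ y) k₁
  ...       | y>p , k₂ with split-beyond x x>p | split-beyond y y>p
  ...         | ex , x≡ | ey , y≡ = in-K _ _ x≡ y≡ (subst₂ (λ u v → T (rel K u v)) ex ey k₂)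
  grafted-view x y h | inj₂ h₂ with T-∧⁻ (inRangeᵇ x 1 p) h₂
  ... | x∈A , k with T-∧⁻ (p <ᵇ suc p) k
  ...   | _ , k₁ with T-∧⁻ (p <ᵇ y) k₁
  ...     | y>p , k₂ with split-beyond y y>p
  ...       | ey , y≡ = grafted (proj₁ (inRange⁻ {x} x∈A)) (proj₂ (inRange⁻ {x} x∈A)) _ y≡
                          (subst₂ (λ u v → T (rel K u v)) (suc∸ p) ey k₂)

  grafted-intro : ∀ x y → GraftedView x y → T (graftedRel x y)
  grafted-intro x y (in-A h) = T-∨ˡ (concatRel A K x y) (T-∨ˡ (rel A x y) h)
  grafted-intro x y (in-K a b refl refl h) = T-∨ˡ (concatRel A K x y) (T-∨ʳ (rel A x y)
    (T-∧⁺ (<⇒<ᵇ (s≤s (m≤m+n p a))) (T-∧⁺ (<⇒<ᵇ (s≤s (m≤m+n p b)))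
      (subst₂ (λ u v → T (rel K u v)) (sym (suc+∸ p a)) (sym (suc+∸ p b)) h))))
  grafted-intro x y (grafted x≥1 x≤p b refl h) = T-∨ʳ (concatRel A K x y) (T-∧⁺ (inRange⁺ x≥1 x≤p)
    (T-∧⁺ (<⇒<ᵇ (n<1+n p)) (T-∧⁺ (<⇒<ᵇ (s≤s (m≤m+n p b)))
      (subst₂ (λ u v → T (rel K u v)) (sym (suc∸ p)) (sym (suc+∸ p b)) h))))

  private
    beyond-A : ∀ b → suc p + b ≤ p → ⊥
    beyond-A b h = <⇒≱ (s≤s (m≤m+n p b)) h

  grafted-trans : IsTransitive graftedRel
  grafted-trans a b c h₁ h₂ with grafted-view a b h₁ | grafted-view b c h₂
  ... | in-A r₁ | in-A r₂ = grafted-intro a c (in-A (trans-A a b c r₁ r₂))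
  ... | in-A r₁ | in-K _ _ refl _ _ = ⊥-elim (beyond-A _ (proj₂ (proj₂ (support-A a _ r₁))))
  ... | in-A r₁ | grafted _ _ c′ c≡ r₂ =
    grafted-intro a c (grafted (proj₁ (proj₁ (support-A a b r₁))) (proj₂ (proj₁ (support-A a b r₁))) c′ c≡ r₂)
  ... | in-K _ _ _ refl _ | in-A r₂ = ⊥-elim (beyond-A _ (proj₂ (proj₁ (support-A _ c r₂))))
  ... | in-K a′ b′ a≡ refl r₁ | in-K b″ c′ b≡ c≡ r₂ with +-cancelˡ-≡ (suc p) b′ b″ b≡
  ...   | refl = grafted-intro a c (in-K a′ c′ a≡ c≡ (trans-K _ _ _ r₁ r₂))
  grafted-trans a b c h₁ h₂ | in-K _ _ _ refl _ | grafted _ b≤p _ _ _ = ⊥-elim (beyond-A _ b≤p)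
  grafted-trans a b c h₁ h₂ | grafted _ _ _ refl _ | in-A r₂ = ⊥-elim (beyond-A _ (proj₂ (proj₁ (support-A _ c r₂))))
  grafted-trans a b c h₁ h₂ | grafted a≥1 a≤p b′ refl r₁ | in-K b″ c′ b≡ c≡ r₂ with +-cancelˡ-≡ (suc p) b′ b″ b≡
  ... | refl = grafted-intro a c (grafted a≥1 a≤p c′ c≡ (trans-K _ _ _ r₁ r₂))
  grafted-trans a b c h₁ h₂ | grafted _ _ _ refl _ | grafted _ b≤p _ _ _ = ⊥-elim (beyond-A _ b≤p)

  private
    base⊆grafted : ∀ x y → T (base x y) → T (graftedRel x y)
    base⊆grafted x y h with T-∨⁻ (concatRel A K x y) h
    ... | inj₁ h₁ = T-∨ˡ (concatRel A K x y) h₁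
    ... | inj₂ h₂ with T-∧⁻ (inRangeᵇ x 1 p) (proj₂ (T-∧⁻ (0 <ᵇ size K) h₂))
    ...   | x∈A , y≡ with ≡ᵇ⁻ {y} y≡
    ...     | refl = grafted-intro x (suc p) (grafted (proj₁ (inRange⁻ {x} x∈A)) (proj₂ (inRange⁻ {x} x∈A)) 0 (sym (+-identityʳ (suc p))) refl-K₁)

    grafted-path : ∀ x y → T (graftedRel x y) →
      T (base x y) ⊎ Σ ℕ (λ k → 1 ≤ k × k ≤ p + size K × T (base x k) × T (base k y))
    grafted-path x y h with T-∨⁻ (concatRel A K x y) h
    ... | inj₁ h₁ = inj₁ (T-∨ˡ (concatRel A K x y) h₁)
    ... | inj₂ h₂ with T-∧⁻ (inRangeᵇ x 1 p) h₂
    ...   | x∈A , k = inj₂ (suc p , s≤s z≤n , root≤ ,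
             T-∨ʳ (concatRel A K x (suc p)) (T-∧⁺ K-nonempty (T-∧⁺ x∈A (≡ᵇ⁺ {suc p} refl))) ,
             T-∨ˡ (concatRel A K (suc p) y) (T-∨ʳ (rel A (suc p) y) k))
      where
      root≤ : suc p ≤ p + size K
      root≤ = subst (_≤ p + size K) (+-comm p 1) (+-monoʳ-≤ p (<ᵇ⇒< 0 (size K) K-nonempty))

  leftGraft-rel : ∀ x y → rel (leftGraft A K) x y ≡ graftedRel x y
  leftGraft-rel = warshall-char base graftedRel (p + size K) base⊆grafted grafted-trans grafted-path

-- The lower tree is a comb whose
-- right subtrees form the forest below; at a node (L, l, R) the root
-- adopts the first l trees of the forest of R as the right subtrees of
-- its own right comb, which is how  u ≻_l  attaches the first l
-- decreasing roots of R to it.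

forest : LTree → List BinTree
forest lleaf         = []
forest (lnode L l R) = forest L ++ (comb (take l (forest R)) ∷ drop l (forest R))

lower : LTree → BinTree
lower t = comb (forest t)

comb-split : ∀ l F → comb F ≡ foldl node (comb (take l F)) (drop l F)
comb-split l F = trans (cong comb (sym (take++drop≡id l F))) (foldl-++ node leaf (take l F) (drop l F))

lower-node : ∀ L l R → lower (lnode L l R) ≡ foldl node (node (lower L) (comb (take l (forest R)))) (drop l (forest R))
lower-node L l R = foldl-++ node leaf (forest L) _

nodes-lower : ∀ t → nodes (lower t) ≡ lsize t
nodes-lower lleaf         = refl
nodes-lower (lnode L l R) = begin
  nodes (lower (lnode L l R))                  ≡⟨ cong nodes (lower-node L l R) ⟩
  nodes (foldl node (node (lower L) X) D)      ≡⟨ nodes-foldl (node (lower L) X) D ⟩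
  suc (nodes (lower L) + nodes X) + nodes (comb D) ≡⟨ cong suc (+-assoc (nodes (lower L)) (nodes X) _) ⟩
  suc (nodes (lower L) + (nodes X + nodes (comb D))) ≡⟨ cong (λ z → suc (nodes (lower L) + z)) (sym (nodes-foldl X D)) ⟩
  suc (nodes (lower L) + nodes (foldl node X D)) ≡⟨ cong (λ z → suc (nodes (lower L) + nodes z)) (sym (comb-split l (forest R))) ⟩
  suc (nodes (lower L) + nodes (lower R))      ≡⟨ cong₂ (λ a b → suc (a + b)) (nodes-lower L) (nodes-lower R) ⟩
  lsize (lnode L l R)                          ∎
  where
  open ≡-Reasoning
  X = comb (take l (forest R))
  D = drop l (forest R)

lower-≤Tam : ∀ t → lower t ≤Tam shape t
lower-≤Tam lleaf         = ε
lower-≤Tam (lnode L l R) = subst (_≤Tam node (shape L) (shape R)) (sym (lower-node L l R))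
  (foldl-≤Tam (lower L) (comb (take l (forest R))) (drop l (forest R))
   ◅◅ subst (λ z → node (lower L) z ≤Tam node (shape L) (shape R)) (comb-split l (forest R))
        (node-≤Tam (lower-≤Tam L) (lower-≤Tam R)))

size-graftInv : ∀ t → size (graftInv t) ≡ lsize t
size-graftInv lleaf         = refl
size-graftInv (lnode L l R) = trans (+-suc (size (graftInv L)) (size (graftInv R)))
  (cong suc (cong₂ _+_ (size-graftInv L) (size-graftInv R)))

-- The forest has as many trees as the size minus the sum of the labels;
-- hence the grafting-tree condition says that each label l at a node
-- with right subtree R is at most the number of trees in the forest of R.
length-forest : ∀ t → IsGraftingTree t → length (forest t) + lsum t ≡ lsize t
label≤forest : ∀ L l R → IsGraftingTree (lnode L l R) → l ≤ length (forest R)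

length-forest lleaf         _              = refl
length-forest (lnode L l R) (gL , gR , ok) = begin
  length (forest L ++ (X ∷ drop l F)) + (lsum L + l + lsum R)
    ≡⟨ cong (_+ (lsum L + l + lsum R)) (trans (length-++ (forest L)) (cong (λ z → length (forest L) + suc z) (length-drop l F))) ⟩
  length (forest L) + suc (length F ∸ l) + (lsum L + l + lsum R)
    ≡⟨ cong (λ z → length (forest L) + suc (z ∸ l) + (lsum L + l + lsum R)) |F|≡ ⟩
  length (forest L) + suc (l + d ∸ l) + (lsum L + l + lsum R)
    ≡⟨ cong (λ z → length (forest L) + suc z + (lsum L + l + lsum R)) (m+n∸m≡n l d) ⟩
  length (forest L) + suc d + (lsum L + l + lsum R)
    ≡⟨ solve 5 (λ a dd sL ll sR → a :+ (con 1 :+ dd) :+ (sL :+ ll :+ sR) := con 1 :+ ((a :+ sL) :+ ((ll :+ dd) :+ sR)))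
             refl (length (forest L)) d (lsum L) l (lsum R) ⟩
  suc ((length (forest L) + lsum L) + ((l + d) + lsum R))
    ≡⟨ cong suc (cong₂ _+_ (length-forest L gL) (trans (cong (_+ lsum R) (sym |F|≡)) (length-forest R gR))) ⟩
  lsize (lnode L l R) ∎
  where
  open ≡-Reasoning
  open +-*-Solver
  F = forest R
  X = comb (take l F)
  d = length F ∸ l
  |F|≡ : length F ≡ l + d
  |F|≡ = sym (m+[n∸m]≡n (label≤forest L l R (gL , gR , ok)))

label≤forest L l R (_ , gR , ok) = +-cancelʳ-≤ (lsum R) l (length (forest R)) (subst (l + lsum R ≤_) (sym (length-forest R gR)) ok)

treeIP : LTree → IPos
treeIP t = IP (lower t) (shape t)

take-++-length : ∀ (xs ys : List ℕ) n → n ≡ length xs → take n (xs ++ ys) ≡ xs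
take-++-length []       ys zero    e = refl
take-++-length (x ∷ xs) ys (suc n) e = cong (x ∷_) (take-++-length xs ys n (suc-injective e))

∨-reassoc : ∀ f a b c → (f ∨ (a ∨ b)) ∨ c ≡ (f ∨ a) ∨ (b ∨ c)
∨-reassoc true  a     b c = refl
∨-reassoc false true  b c = refl
∨-reassoc false false b c = refl

module NodeStructure (L : LTree) (l : ℕ) (R : LTree) (l≤forest : l ≤ length (forest R)) where
  -- the root is vertex suc p; the vertices of R follow it; the root's
  -- right subtree in the lower tree is the comb X of the first l trees
  -- of the forest of R, on the vertices suc p + 1, …, suc p + |X|
  p = lsize L
  m = lsize R
  X = comb (take l (forest R))
  D = drop l (forest R)
  |X| = nodes X

  lowerR-split : lower R ≡ foldl node X D
  lowerR-split = comb-split l (forest R)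

  |X|≤m : |X| ≤ m
  |X|≤m = subst (|X| ≤_) (trans (sym (nodes-foldl X D)) (trans (cong nodes (sym lowerR-split)) (nodes-lower R))) (m≤m+n |X| _)

  selected-spine : ∀ (J : IPos) → size J ≡ m → (∀ x y → rel J x y ≡ rel (treeIP R) x y) →
                   selected J l ≡ map suc (spine X 0)
  selected-spine J eqS eqR = begin
    take l (map suc (decRoots J))           ≡⟨ cong (λ z → take l (map suc z)) (decRoots-IP J (lower R) (shape R) (trans eqS (sym (nodes-lower R))) eqR) ⟩
    take l (map suc (spine (lower R) 0))    ≡⟨ take-map l (spine (lower R) 0) ⟩
    map suc (take l (spine (lower R) 0))    ≡⟨ cong (λ t → map suc (take l (spine t 0))) lowerR-split ⟩
    map suc (take l (spine (foldl node X D) 0)) ≡⟨ cong (λ z → map suc (take l z)) (spine-foldl X D 0) ⟩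
    map suc (take l (spine X 0 ++ _))       ≡⟨ cong (map suc) (take-++-length (spine X 0) _ l (sym |spineX|≡l)) ⟩
    map suc (spine X 0) ∎
    where
    open ≡-Reasoning
    |spineX|≡l : length (spine X 0) ≡ l
    |spineX|≡l = trans (length-spine X 0) (trans (spineLength-comb (take l (forest R)))
                   (trans (length-take l (forest R)) (m≤n⇒m⊓n≡m l≤forest)))

  rightSub-lowerNode : ∀ x y → rightSubᵇ (lower (lnode L l R)) 0 x y ≡
    (((y ≡ᵇ suc p) ∧ inRangeᵇ x (suc (suc p)) (suc (p + |X|))) ∨ rightSubᵇ (lower L) 0 x y) ∨ rightSubᵇ (lower R) (suc p) x y
  rightSub-lowerNode x y = begin
    rightSubᵇ (lower (lnode L l R)) 0 x y
      ≡⟨ cong (λ t → rightSubᵇ t 0 x y) (lower-node L l R) ⟩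
    rightSubᵇ (foldl node (node (lower L) X) D) 0 x y
      ≡⟨ rightSub-foldl (node (lower L) X) D 0 x y ⟩
    (arm q ∨ (rightSubᵇ (lower L) 0 x y ∨ rightSubᵇ X (suc q) x y)) ∨ rightSubᵇ (comb D) (suc (q + |X|)) x y
      ≡⟨ ∨-reassoc (arm q) (rightSubᵇ (lower L) 0 x y) _ _ ⟩
    (arm q ∨ rightSubᵇ (lower L) 0 x y) ∨ (rightSubᵇ X (suc q) x y ∨ rightSubᵇ (comb D) (suc q + |X|) x y)
      ≡⟨ cong ((arm q ∨ rightSubᵇ (lower L) 0 x y) ∨_) (sym (rightSub-foldl X D (suc q) x y)) ⟩
    (arm q ∨ rightSubᵇ (lower L) 0 x y) ∨ rightSubᵇ (foldl node X D) (suc q) x y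
      ≡⟨ cong (λ t → (arm q ∨ rightSubᵇ (lower L) 0 x y) ∨ rightSubᵇ t (suc q) x y) (sym lowerR-split) ⟩
    (arm q ∨ rightSubᵇ (lower L) 0 x y) ∨ rightSubᵇ (lower R) (suc q) x y
      ≡⟨ cong (λ q → (arm q ∨ rightSubᵇ (lower L) 0 x y) ∨ rightSubᵇ (lower R) (suc q) x y) (nodes-lower L) ⟩
    (arm p ∨ rightSubᵇ (lower L) 0 x y) ∨ rightSubᵇ (lower R) (suc p) x y ∎
    where
    open ≡-Reasoning
    q = nodes (lower L)
    arm : ℕ → Bool
    arm q = (y ≡ᵇ suc q) ∧ inRangeᵇ x (suc (suc q)) (suc (q + |X|))

  data NodeRel (x y : ℕ) : Set where
    in-L    : x ≤ p → y ≤ p → T (rel (treeIP L) x y) → NodeRel x y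
    to-root : 1 ≤ x → x ≤ p → y ≡ suc p → NodeRel x y
    at-root : x ≡ suc p → y ≡ suc p → NodeRel x y
    in-arm  : ∀ e → x ≡ suc p + e → y ≡ suc p → 1 ≤ e → e ≤ |X| → NodeRel x y
    in-R    : ∀ a b → x ≡ suc p + a → y ≡ suc p + b → T (rel (treeIP R) a b) → NodeRel x y

  private
    sL = shape L
    sR = shape R
    Tn = lower (lnode L l R)
    Sn = node sL sR

    arm : ℕ → ℕ → Bool
    arm x y = (y ≡ᵇ suc p) ∧ inRangeᵇ x (suc (suc p)) (suc (p + |X|))

    dec⁺ : ∀ x y → y < x → (T (arm x y) ⊎ T (rightSubᵇ (lower L) 0 x y)) ⊎ T (rightSubᵇ (lower R) (suc p) x y) →
           T (rel (treeIP (lnode L l R)) x y)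
    dec⁺ x y lt c = ip-intro Tn Sn x y (ip-dec lt (subst T (sym (rightSub-lowerNode x y)) (join c)))
      where
      join : (T (arm x y) ⊎ T (rightSubᵇ (lower L) 0 x y)) ⊎ T (rightSubᵇ (lower R) (suc p) x y) →
             T ((arm x y ∨ rightSubᵇ (lower L) 0 x y) ∨ rightSubᵇ (lower R) (suc p) x y)
      join (inj₁ (inj₁ t)) = T-∨ˡ (arm x y ∨ _) (T-∨ˡ (arm x y) t)
      join (inj₁ (inj₂ t)) = T-∨ˡ (arm x y ∨ _) (T-∨ʳ (arm x y) t)
      join (inj₂ t)        = T-∨ʳ (arm x y ∨ _) t

  treeIP-node⁻ : ∀ x y → T (rel (treeIP (lnode L l R)) x y) → NodeRel x y
  treeIP-node⁻ x y h with ip-view Tn Sn x y h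
  ... | ip-refl refl r with inRange⁻ {x} r | <-cmp x (suc p)
  ...   | x≥1 , _ | tri< lt _ _ = in-L (≤-pred lt) (≤-pred lt) (ip-intro (lower L) sL x x (ip-refl refl (inRange⁺ x≥1 (≤-pred lt))))
  ...   | _       | tri≈ _ eq _ = at-root eq eq
  ...   | _ , x≤  | tri> _ _ gt with beyond p x (<-trans (n<1+n p) gt)
  ...     | a , refl = in-R a a refl refl (ip-intro (lower R) sR a a (ip-refl refl (inRange⁺ (positive (suc p) a gt) (+-cancelˡ-≤ (suc p) a m x≤))))
  treeIP-node⁻ x y h | ip-inc lt r with T-∨⁻ ((y ≡ᵇ suc p) ∧ inRangeᵇ x 1 p) r
  ... | inj₁ r₁ with T-∧⁻ (y ≡ᵇ suc p) r₁
  ...   | y≡ , x∈L = to-root (proj₁ (inRange⁻ {x} x∈L)) (proj₂ (inRange⁻ {x} x∈L)) (≡ᵇ⁻ {y} y≡)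
  treeIP-node⁻ x y h | ip-inc lt r | inj₂ r₂ with T-∨⁻ (leftSubᵇ sL 0 x y) r₂
  ... | inj₁ rL with leftSub-support sL 0 x y rL
  ...   | _ , x<y , y≤p = in-L (≤-trans (<⇒≤ x<y) y≤p) y≤p (ip-intro (lower L) sL x y (ip-inc lt rL))
  treeIP-node⁻ x y h | ip-inc lt r | inj₂ r₂ | inj₂ rR with leftSub-support sR (suc p) x y rR
  ... | root<x , x<y , _ with beyond p x (<-trans (n<1+n p) root<x) | beyond p y (<-trans (n<1+n p) (<-trans root<x x<y))
  ...   | a , refl | b , refl = in-R a b refl refl
          (ip-intro (lower R) sR a b (ip-inc (+-cancelˡ-< (suc p) a b lt) (subst T (leftSub-shift₀ (suc p) sR a b) rR)))
  treeIP-node⁻ x y h | ip-dec lt r with T-∨⁻ _ (subst T (rightSub-lowerNode x y) r)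
  ... | inj₁ r₁ with T-∨⁻ (arm x y) r₁
  ...   | inj₂ rL with rightSub-support (lower L) 0 x y rL
  ...     | _ , y<x , x≤ = in-L (subst (x ≤_) (nodes-lower L) x≤) (≤-trans (<⇒≤ y<x) (subst (x ≤_) (nodes-lower L) x≤))
                            (ip-intro (lower L) sL x y (ip-dec lt rL))
  treeIP-node⁻ x y h | ip-dec lt r | inj₁ r₁ | inj₁ rArm with T-∧⁻ (y ≡ᵇ suc p) rArm
  ... | y≡ , x∈X with inRange⁻ {x} x∈X | ≡ᵇ⁻ {y} y≡
  ...   | x> , x≤ | refl with beyond p x (<-trans (n<1+n p) x>)
  ...     | e , refl = in-arm e refl refl (positive (suc p) e x>) (+-cancelˡ-≤ (suc p) e |X| x≤)
  treeIP-node⁻ x y h | ip-dec lt r | inj₂ rR with rightSub-support (lower R) (suc p) x y rR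
  ... | root<y , y<x , _ with beyond p y (<-trans (n<1+n p) root<y) | beyond p x (<-trans (n<1+n p) (<-trans root<y y<x))
  ...   | b , refl | a , refl = in-R a b refl refl
          (ip-intro (lower R) sR a b (ip-dec (+-cancelˡ-< (suc p) b a lt) (subst T (rightSub-shift₀ (suc p) (lower R) a b) rR)))

  treeIP-node⁺ : ∀ x y → NodeRel x y → T (rel (treeIP (lnode L l R)) x y)
  treeIP-node⁺ x y (in-L x≤p _ h) with ip-view (lower L) sL x y h
  ... | ip-refl refl r = ip-intro Tn Sn x y (ip-refl refl (inRange⁺ (proj₁ (inRange⁻ {x} r)) (≤-trans x≤p (≤-trans (m≤m+n p m) (n≤1+n _)))))
  ... | ip-inc lt r    = ip-intro Tn Sn x y (ip-inc lt (T-∨ʳ ((y ≡ᵇ suc p) ∧ inRangeᵇ x 1 p) (T-∨ˡ (leftSubᵇ sL 0 x y) r)))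
  ... | ip-dec lt r    = dec⁺ x y lt (inj₁ (inj₂ r))
  treeIP-node⁺ x y (to-root x≥1 x≤p refl) =
    ip-intro Tn Sn x y (ip-inc (s≤s x≤p) (T-∨ˡ ((y ≡ᵇ suc p) ∧ _) (T-∧⁺ (≡ᵇ⁺ {suc p} refl) (inRange⁺ x≥1 x≤p))))
  treeIP-node⁺ x y (at-root refl refl) = ip-intro Tn Sn x y (ip-refl refl (inRange⁺ (s≤s z≤n) (s≤s (m≤m+n p m))))
  treeIP-node⁺ x y (in-arm e refl refl e≥1 e≤X) =
    dec⁺ x y y<x (inj₁ (inj₁ (T-∧⁺ (≡ᵇ⁺ {suc p} refl) (inRange⁺ y<x (s≤s (+-monoʳ-≤ p e≤X))))))
    where
    y<x : suc p < suc p + e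
    y<x = subst (_≤ suc p + e) (cong suc (+-comm p 1)) (s≤s (+-monoʳ-≤ p e≥1))
  treeIP-node⁺ x y (in-R a b refl refl h) with ip-view (lower R) sR a b h
  ... | ip-refl refl r = ip-intro Tn Sn x y (ip-refl refl (inRange⁺ (s≤s z≤n) (s≤s (+-monoʳ-≤ p (proj₂ (inRange⁻ {a} r))))))
  ... | ip-inc lt r    = ip-intro Tn Sn x y (ip-inc (+-monoʳ-< (suc p) lt)
                           (T-∨ʳ ((y ≡ᵇ suc p) ∧ inRangeᵇ x 1 p) (T-∨ʳ (leftSubᵇ sL 0 x y) (subst T (sym (leftSub-shift₀ (suc p) sR a b)) r))))
  ... | ip-dec lt r    = dec⁺ x y (+-monoʳ-< (suc p) lt) (inj₂ (subst T (sym (rightSub-shift₀ (suc p) (lower R) a b)) r))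

module GraftStep (L : LTree) (l : ℕ) (R : LTree) (l≤forest : l ≤ length (forest R))
  (relA relJ : BRel)
  (relA≡ : ∀ x y → relA x y ≡ rel (treeIP L) x y) (relJ≡ : ∀ x y → relJ x y ≡ rel (treeIP R) x y)
  (trans-L : IsTransitive (rel (treeIP L))) (trans-R : IsTransitive (rel (treeIP R))) where

  open NodeStructure L l R l≤forest

  A : IPos
  A = record { size = p ; rel = relA }

  J : IPos
  J = record { size = m ; rel = relJ }

  private
    J→R : ∀ {x y} → T (relJ x y) → T (rel (treeIP R) x y)
    J→R {x} {y} = subst T (relJ≡ x y)

    R→J : ∀ {x y} → T (rel (treeIP R) x y) → T (relJ x y)
    R→J {x} {y} = subst T (sym (relJ≡ x y))

    trans-J : IsTransitive relJ
    trans-J x y z a b = R→J (trans-R x y z (J→R a) (J→R b))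

    refl-J : ∀ z → 1 ≤ z → z ≤ m → T (relJ z z)
    refl-J z z≥1 z≤m = R→J (subst T (sym (IP-refl (lower R) (shape R) z)) (inRange⁺ z≥1 z≤m))

    support-A : ∀ x y → T (relA x y) → (1 ≤ x × x ≤ p) × (1 ≤ y × y ≤ p)
    support-A x y h = IP-support (lower L) (shape L) (nodes-lower L) x y (subst T (relA≡ x y) h)

    support-R : ∀ a b → T (rel (treeIP R) a b) → (1 ≤ a × a ≤ m) × (1 ≤ b × b ≤ m)
    support-R = IP-support (lower R) (shape R) (nodes-lower R)

    S = selected J l

    S≡ : S ≡ map suc (spine X 0)
    S≡ = selected-spine J refl relJ≡

    S⁻ : ∀ z → z ∈ S → Σ ℕ λ z′ → z ≡ suc z′ × z′ ∈ spine X 0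
    S⁻ z z∈S with ∈-map⁻ suc (subst (z ∈_) S≡ z∈S)
    ... | z′ , z′∈ , refl = z′ , refl , z′∈

    S⁺ : ∀ z′ → z′ ∈ spine X 0 → suc z′ ∈ S
    S⁺ z′ z′∈ = subst (suc z′ ∈_) (sym S≡) (∈-map⁺ suc z′∈)

    selected-ok : ∀ z → z ∈ S → Σ ℕ λ z′ → z ≡ suc z′ × 1 ≤ z′ × z′ ≤ m × T (relJ z′ z′)
    selected-ok z z∈S with S⁻ z z∈S
    ... | z′ , refl , z′∈ with spine-∈ X 0 z′ z′∈
    ...   | z′≥1 , z′≤X = z′ , refl , z′≥1 , ≤-trans z′≤X |X|≤m , refl-J z′ z′≥1 (≤-trans z′≤X |X|≤m)

  K : IPos
  K = rightGraft uIP l J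

  module KG = RightGraftU J l trans-J selected-ok

  private
    K→ : ∀ {x y} → T (rel K x y) → T (KG.graftedRel x y)
    K→ {x} {y} = subst T (KG.rightGraftU-rel x y)

    →K : ∀ {x y} → T (KG.graftedRel x y) → T (rel K x y)
    →K {x} {y} = subst T (sym (KG.rightGraftU-rel x y))

    trans-K : IsTransitive (rel K)
    trans-K x y z a b = →K (KG.grafted-trans x y z (K→ a) (K→ b))

    refl-K₁ : T (rel K 1 1)
    refl-K₁ = →K (KG.grafted-intro 1 1 (KG.at-u refl refl))

  module LG = LeftGraft A K (λ x y z a b → subst T (sym (relA≡ x z)) (trans-L x y z (subst T (relA≡ x y) a) (subst T (relA≡ y z) b)))
                        trans-K support-A tt refl-K₁

  private
    below-arm : ∀ e z′ → z′ ∈ spine X 0 → T (rel (treeIP R) e z′) → e ≤ |X|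
    below-arm e z′ z′∈ h with spine-∈ X 0 z′ z′∈
    ... | _ , z′≤X with ip-view (lower R) (shape R) e z′ h
    ...   | ip-refl refl _ = z′≤X
    ...   | ip-inc lt _    = ≤-trans (<⇒≤ lt) z′≤X
    ...   | ip-dec lt r with T-∨⁻ (rightSubᵇ X 0 e z′) (subst T (rightSub-foldl X D 0 e z′) (subst (λ t → T (rightSubᵇ t 0 e z′)) lowerR-split r))
    ...     | inj₁ rX = proj₂ (proj₂ (rightSub-support X 0 e z′ rX))
    ...     | inj₂ rD = ⊥-elim (<⇒≱ (proj₁ (rightSub-support (comb D) |X| e z′ rD)) z′≤X)

    arm-below : ∀ e → 1 ≤ e → e ≤ |X| → T (any (shift₁ relJ (suc e)) S)
    arm-below e e≥1 e≤X with below-spine X 0 e (e≥1 , e≤X)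
    ... | z′ , z′∈ , how with spine-∈ X 0 z′ z′∈
    ...   | z′≥1 , _ = any-intro (shift₁ relJ (suc e)) (S⁺ z′ z′∈) (shift₁⁺ relJ e z′ e≥1 z′≥1 (J-rel how))
      where
      J-rel : e ≡ z′ ⊎ T (rightSubᵇ X 0 e z′) → T (relJ e z′)
      J-rel (inj₁ refl) = refl-J e e≥1 (≤-trans e≤X |X|≤m)
      J-rel (inj₂ r)    = R→J (subst T (sym (IP-dec (lower R) (shape R) e z′ (proj₁ (proj₂ (rightSub-support X 0 e z′ r)))))
                          (subst (λ t → T (rightSubᵇ t 0 e z′)) (sym lowerR-split) (subst T (sym (rightSub-foldl X D 0 e z′)) (T-∨ˡ _ r))))

    at₀ : suc p ≡ suc p + 0
    at₀ = sym (+-identityʳ (suc p))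

  grafted⁻ : ∀ x y → T (LG.graftedRel x y) → NodeRel x y
  grafted⁻ x y h with LG.grafted-view x y h
  ... | LG.in-A r = in-L (proj₂ (proj₁ (support-A x y r))) (proj₂ (proj₂ (support-A x y r))) (subst T (relA≡ x y) r)
  ... | LG.in-K a b x≡ y≡ r with KG.grafted-view (suc a) (suc b) (K→ r)
  ...   | KG.at-u refl refl = at-root (trans x≡ (sym at₀)) (trans y≡ (sym at₀))
  ...   | KG.in-J j with shift₁⁻ relJ (suc a) (suc b) j
  ...     | _ , _ , refl , refl , _ , _ , rj = in-R a b x≡ y≡ (J→R rj)
  grafted⁻ x y h | LG.in-K a b x≡ y≡ r | KG.grafted refl below with any-witness (shift₁ relJ (suc a)) S below
  ... | z , z∈S , jz with S⁻ z z∈S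
  ...   | z′ , refl , z′∈ with shift₁⁻ relJ (suc a) (suc z′) jz
  ...     | _ , _ , refl , refl , a≥1 , _ , rj = in-arm a x≡ (trans y≡ (sym at₀)) a≥1 (below-arm a z′ z′∈ (J→R rj))
  grafted⁻ x y h | LG.grafted x≥1 x≤p b y≡ r with KG.grafted-view 1 (suc b) (K→ r)
  ... | KG.at-u _ refl    = to-root x≥1 x≤p (trans y≡ (sym at₀))
  ... | KG.in-J j         = ⊥-elim (KG.Jₛ-from-1 (suc b) j)
  ... | KG.grafted refl _ = to-root x≥1 x≤p (trans y≡ (sym at₀))

  grafted⁺ : ∀ x y → NodeRel x y → T (LG.graftedRel x y)
  grafted⁺ x y (in-L _ _ h) = LG.grafted-intro x y (LG.in-A (subst T (sym (relA≡ x y)) h))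
  grafted⁺ x y (to-root x≥1 x≤p refl) = LG.grafted-intro x y (LG.grafted x≥1 x≤p 0 at₀ refl-K₁)
  grafted⁺ x y (at-root refl refl) = LG.grafted-intro x y (LG.in-K 0 0 at₀ at₀ refl-K₁)
  grafted⁺ x y (in-arm e refl refl e≥1 e≤X) =
    LG.grafted-intro x y (LG.in-K e 0 refl at₀ (→K (KG.grafted-intro (suc e) 1 (KG.grafted refl (arm-below e e≥1 e≤X)))))
  grafted⁺ x y (in-R a b refl refl h) with support-R a b h
  ... | (a≥1 , _) , (b≥1 , _) =
    LG.grafted-intro x y (LG.in-K a b refl refl (→K (KG.grafted-intro (suc a) (suc b) (KG.in-J (shift₁⁺ relJ a b a≥1 b≥1 (R→J h))))))

  grafted≡ : ∀ x y → LG.graftedRel x y ≡ rel (treeIP (lnode L l R)) x y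
  grafted≡ x y = T-ext (λ h → treeIP-node⁺ x y (grafted⁻ x y h)) (λ h → grafted⁺ x y (treeIP-node⁻ x y h))

  graftStep-rel : ∀ x y → rel (leftGraft A K) x y ≡ rel (treeIP (lnode L l R)) x y
  graftStep-rel x y = trans (LG.leftGraft-rel x y) (grafted≡ x y)

  graftStep-trans : IsTransitive (rel (treeIP (lnode L l R)))
  graftStep-trans a b c h₁ h₂ = subst T (grafted≡ a c)
    (LG.grafted-trans a b c (subst T (sym (grafted≡ a b)) h₁) (subst T (sym (grafted≡ b c)) h₂))

-- Graft⁻¹ t has the relations of treeIP t, and the latter is transitive
-- (the transitivity is needed to compute the next grafting).
record Realises (t : LTree) : Set where
  field
    rel≡  : ∀ x y → rel (graftInv t) x y ≡ rel (treeIP t) x y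
    transitive : IsTransitive (rel (treeIP t))

graftInv-realises : ∀ t → IsGraftingTree t → Realises t
graftInv-realises lleaf _ = record { rel≡ = λ x y → T-ext (λ ()) (λ h → ⊥-elim (empty x y h))
                                   ; transitive = λ x y z h → ⊥-elim (empty x y h) }
  where
  empty : ∀ x y → T (rel (treeIP lleaf) x y) → ⊥
  empty x y h with IP-support leaf leaf refl x y h
  ... | (x≥1 , x≤0) , _ = <⇒≱ x≥1 x≤0
graftInv-realises (lnode L l R) g@(gL , gR , _) = record { rel≡ = rel≡ ; transitive = graftStep-trans }
  where
  IL = graftInv-realises L gL
  IR = graftInv-realises R gR
  open GraftStep L l R (label≤forest L l R g) (rel (graftInv L)) (rel (graftInv R))
                 (Realises.rel≡ IL) (Realises.rel≡ IR) (Realises.transitive IL) (Realises.transitive IR)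
  -- Graft⁻¹ L and Graft⁻¹ R enter the grafting only through their sizes and relations
  as-graft : graftInv (lnode L l R) ≡ leftGraft A K
  as-graft = cong₂ (λ s s′ → leftGraft (record { size = s ; rel = rel (graftInv L) })
                                       (rightGraft uIP l (record { size = s′ ; rel = rel (graftInv R) })))
                   (size-graftInv L) (size-graftInv R)
  rel≡ : ∀ x y → rel (graftInv (lnode L l R)) x y ≡ rel (treeIP (lnode L l R)) x y
  rel≡ x y = trans (cong (λ I → rel I x y) as-graft) (graftStep-rel x y)

module _ (L : LTree) (l : ℕ) (R : LTree) (i : ℕ) where
  labelAt-inLeft : i ≤ lsize L → labelAt (lnode L l R) i ≡ labelAt L i
  labelAt-inLeft h rewrite T⇒≡true (≤⇒≤ᵇ h) = refl

  labelAt-beyondLeft : lsize L < i →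
    labelAt (lnode L l R) i ≡ (if i ≡ᵇ suc (lsize L) then l else labelAt R (i ∸ suc (lsize L)))
  labelAt-beyondLeft h rewrite ¬T⇒≡false (λ t → <⇒≱ h (≤ᵇ⁻ {i} t)) = refl

labelAt-atRoot : ∀ L l R → labelAt (lnode L l R) (suc (lsize L)) ≡ l
labelAt-atRoot L l R rewrite labelAt-beyondLeft L l R (suc (lsize L)) ≤-refl | T⇒≡true (≡ᵇ⁺ {suc (lsize L)} refl) = refl

labelAt-inRight : ∀ L l R a → 1 ≤ a → labelAt (lnode L l R) (suc (lsize L) + a) ≡ labelAt R a
labelAt-inRight L l R a a≥1 rewrite labelAt-beyondLeft L l R (suc (lsize L) + a) (s≤s (m≤m+n _ a))
                                  | ¬T⇒≡false (λ t → <-irrefl (sym (≡ᵇ⁻ {suc (lsize L) + a} t)) (m<m+n (suc (lsize L)) a≥1))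
                                  | m+n∸m≡n (suc (lsize L)) a = refl

module LabelStep (L : LTree) (l : ℕ) (R : LTree) (l≤forest : l ≤ length (forest R))
  (IH-L : ∀ i → 1 ≤ i → i ≤ lsize L → labelAt L i ≡ rightArm (lower L) 0 i)
  (IH-R : ∀ i → 1 ≤ i → i ≤ lsize R → labelAt R i ≡ rightArm (lower R) 0 i) where
  open NodeStructure L l R l≤forest
  open ≡-Reasoning

  private
    root≡ : root# (lower L) 0 ≡ suc p
    root≡ = cong suc (nodes-lower L)

    lower-upToRoot : ∀ i → i ≤ suc p → rightArm (lower (lnode L l R)) 0 i ≡ rightArm (node (lower L) X) 0 i
    lower-upToRoot i i≤ = trans (cong (λ t → rightArm t 0 i) (lower-node L l R))
      (rightArm-foldl-inside (node (lower L) X) D 0 i (≤-trans (subst (i ≤_) (sym root≡) i≤) (root#≤last# 0 (lower L) X)))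

  label-node : ∀ i → 1 ≤ i → i ≤ lsize (lnode L l R) → labelAt (lnode L l R) i ≡ rightArm (lower (lnode L l R)) 0 i
  label-node i i≥1 i≤n with <-cmp i (suc p)
  ... | tri< lt _ _ = begin
    labelAt (lnode L l R) i              ≡⟨ labelAt-inLeft L l R i (≤-pred lt) ⟩
    labelAt L i                          ≡⟨ IH-L i i≥1 (≤-pred lt) ⟩
    rightArm (lower L) 0 i               ≡⟨ sym (rightArm-inLeft (lower L) X 0 i (subst (i ≤_) (sym (nodes-lower L)) (≤-pred lt))) ⟩
    rightArm (node (lower L) X) 0 i      ≡⟨ sym (lower-upToRoot i (<⇒≤ lt)) ⟩
    rightArm (lower (lnode L l R)) 0 i   ∎
  ... | tri≈ _ refl _ = begin
    labelAt (lnode L l R) (suc p)        ≡⟨ labelAt-atRoot L l R ⟩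
    l                                    ≡⟨ sym (m≤n⇒m⊓n≡m l≤forest) ⟩
    l ⊓ length (forest R)                ≡⟨ sym (length-take l (forest R)) ⟩
    length (take l (forest R))           ≡⟨ sym (spineLength-comb (take l (forest R))) ⟩
    spineLength X                        ≡⟨ sym (rightArm-atRoot (lower L) X 0) ⟩
    rightArm (node (lower L) X) 0 (root# (lower L) 0) ≡⟨ cong (rightArm (node (lower L) X) 0) root≡ ⟩
    rightArm (node (lower L) X) 0 (suc p) ≡⟨ sym (lower-upToRoot (suc p) ≤-refl) ⟩
    rightArm (lower (lnode L l R)) 0 (suc p) ∎
  ... | tri> _ _ gt with beyond p i (<-trans (n<1+n p) gt)
  ...   | a , refl = begin
    labelAt (lnode L l R) (suc p + a)                         ≡⟨ labelAt-inRight L l R a a≥1 ⟩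
    labelAt R a                                               ≡⟨ IH-R a a≥1 (+-cancelˡ-≤ (suc p) a m i≤n) ⟩
    rightArm (lower R) 0 a                                    ≡⟨ sym (rightArm-shift (suc p) (lower R) 0 a) ⟩
    rightArm (lower R) (suc p + 0) (suc p + a)                ≡⟨ cong₂ (λ o t → rightArm t o (suc p + a)) (+-identityʳ (suc p)) lowerR-split ⟩
    rightArm (foldl node X D) (suc p) (suc p + a)             ≡⟨ cong (λ o → rightArm (foldl node X D) o (suc p + a)) (sym root≡) ⟩
    rightArm (foldl node X D) (root# (lower L) 0) (suc p + a)
      ≡⟨ sym (rightArm-foldl-node (lower L) X D 0 (suc p + a) (subst (_< suc p + a) (sym root≡) gt)) ⟩
    rightArm (foldl node (node (lower L) X) D) 0 (suc p + a)  ≡⟨ cong (λ t → rightArm t 0 (suc p + a)) (sym (lower-node L l R)) ⟩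
    rightArm (lower (lnode L l R)) 0 (suc p + a)              ∎
    where a≥1 = positive (suc p) a gt

label≡rightArm : ∀ t → IsGraftingTree t → ∀ i → 1 ≤ i → i ≤ lsize t → labelAt t i ≡ rightArm (lower t) 0 i
label≡rightArm lleaf         _              i i≥1 i≤0 = ⊥-elim (<⇒≱ i≥1 i≤0)
label≡rightArm (lnode L l R) g@(gL , gR , _) = LabelStep.label-node L l R (label≤forest L l R g) (label≡rightArm L gL) (label≡rightArm R gR)

proposition4p12 : (I : IPos) → IsIntervalPoset I →
    (t : LTree) → IsGraftingTree t → graftInv t ≅ I →
    (Σ BinTree (λ T₁ → (T₁ ≤Tam shape t) × (IP T₁ (shape t) ≅ I)))
    × (∀ i → 1 ≤ i → i ≤ size I → labelAt t i ≡ decChildren I i)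
proposition4p12 I _ t g (eqS , eqR) = (lower t , lower-≤Tam t , treeIP≅I) , labels
  where
  size≡ : lsize t ≡ size I
  size≡ = trans (sym (size-graftInv t)) eqS

  treeIP≅I : treeIP t ≅ I
  treeIP≅I = size≡ , λ x y x≥1 x≤n y≥1 y≤n →
    trans (sym (Realises.rel≡ (graftInv-realises t g) x y))
          (eqR x y x≥1 (subst (x ≤_) (sym (size-graftInv t)) x≤n) y≥1 (subst (y ≤_) (sym (size-graftInv t)) y≤n))

  labels : ∀ i → 1 ≤ i → i ≤ size I → labelAt t i ≡ decChildren I i
  labels i i≥1 i≤ = begin
    labelAt t i                ≡⟨ label≡rightArm t g i i≥1 i≤n ⟩
    rightArm (lower t) 0 i     ≡⟨ sym (decChildren-IP (lower t) (shape t) i (nodes-lower t) i≥1 i≤n) ⟩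
    decChildren (treeIP t) i   ≡⟨ decChildren-cong (treeIP t) I i treeIP≅I i≥1 i≤n ⟩
    decChildren I i            ∎
    where
    open ≡-Reasoning
    i≤n = subst (i ≤_) (sym size≡) i≤
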